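{- Let $\mathbf{w}=w_1w_2\cdots w_k\in\{r,c\}^k$ and $n\ge1$. A permutation $\sigma\in S_{n+k}$ lies in $\mathrm{BSP}(\mathbf{w},n)$ if and only if for all $i$ with $1\le i\le k$: $\sigma^{ -1}(i)<\sigma^{ -1}(n+i)$ whenever $w_i=c$, and $\sigma^{ -1}(i)>\sigma^{ -1}(n+i)$ whenever $w_i=r$.
   Context: Diagrams are drawn in English convention (rows top to bottom, columns left to right); the content of the box in row $i$, column $j$ is $j-i$, and a diagonal is the set of boxes of a given content. A border strip is a set of boxes forming a connected skew shape with no $2\times2$ square; its head is its box of maximal content. For a word $\mathbf{w}$ over $\{r,c\}$ of length $k$ and $n\ge1$, the simple diagram $(\mathbf{w},n)$ is defined recursively: $(\emptyset,n)$ is the $n\times n$ square; $(c\mathbf{w},n)$ is obtained from $(\mathbf{w},n)$ by adjoining a new column of $n$ boxes immediately left of the leftmost column with its bottom box in the bottom row of $(\mathbf{w},n)$; $(r\mathbf{w},n)$ is obtained by adjoining a new row of $n$ boxes immediately below the bottom row with its leftmost box in the leftmost column. The diagonals of $(\mathbf{w},n)$ are numbered starting from the top-right corner: the diagonal containing the top-right box (the box of maximal content) gets number $n+k$, the next lower content gets $n+k-1$, and so on down to $1$. $\mathrm{BST}(\mathbf{w},n)$ is the set of border-strip tableaux of $(\mathbf{w},n)$ with strips of size $n$: fillings of the boxes with $1,\dots,n+k$, each value used exactly $n$ times, rows weakly increasing left to right, columns weakly increasing top to bottom, and the boxes containing each value forming a border strip. In every such tableau each diagonal numbered $1,\dots,n+k$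 contains exactly one head. The map $\psi:\mathrm{BST}(\mathbf{w},n)\to S_{n+k}$ sends $T$ to the permutation $\sigma$ with $\sigma(j)=i$ whenever the head of the strip filled with $j$ lies in diagonal $i$. $\mathrm{BSP}(\mathbf{w},n)\subseteq S_{n+k}$ is the image of $\psi$. -}

module Defs where

open import Data.Nat as ℕ using (ℕ; zero; suc)
open import Data.Integer as ℤ using (ℤ; +_; _-_; _+_)
open import Data.Fin as Fin using (Fin; toℕ)
open import Data.Fin.Properties using (_≟_)
open import Data.Vec using (Vec; []; _∷_)
open import Data.List as List using (List; map; concatMap; upTo; filter; length)
open import Data.List.Membership.Propositional using (_∈_)
open import Data.Product using (_×_; _,_; proj₁; proj₂; ∃-syntax)
open import Data.Sum using (_⊎_)
open import Relation.Binary.PropositionalEquality using (_≡_)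
open import Data.Fin.Permutation using (Permutation′; _⟨$⟩ʳ_)

data Letter : Set where
  r c : Letter

-- A box is (row , column) with integer coordinates (English convention:
-- rows grow downwards, columns grow to the right).
Box : Set
Box = ℤ × ℤ

row col : Box → ℤ
row = proj₁
col = proj₂

content : Box → ℤ
content (i , j) = j - i

-- Coordinates of the simple diagram (w , n): the initial n×n square occupies
-- rows 0..n-1 and columns 0..n-1.  We track the leftmost column and the
-- bottom row of (w , n).
leftCol : ∀ {k} → Vec Letter k → ℤ
leftCol []       = + 0
leftCol (c ∷ w)  = leftCol w - + 1
leftCol (r ∷ w)  = leftCol w

bottomRow : ∀ {k} → ℕ → Vec Letter k → ℤ
bottomRow n []      = + n - + 1
bottomRow n (c ∷ w) = bottomRow n w
bottomRow n (r ∷ w) = bottomRow n w + + 1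

boxes : ∀ {k} → Vec Letter k → ℕ → List Box
boxes [] n = concatMap (λ i → map (λ j → (+ i , + j)) (upTo n)) (upTo n)
-- (c w , n): new column of n boxes immediately left of the leftmost column,
-- bottom box in the bottom row of (w , n)
boxes (c ∷ w) n = boxes w n List.++
  map (λ t → (bottomRow n w - + n + + 1 + + t , leftCol w - + 1)) (upTo n)
-- (r w , n): new row of n boxes immediately below the bottom row,
-- leftmost box in the leftmost column of (w , n)
boxes (r ∷ w) n = boxes w n List.++
  map (λ t → (bottomRow n w + + 1 , leftCol w + + t)) (upTo n)

InDiagram : ∀ {k} → Vec Letter k → ℕ → Box → Set
InDiagram w n b = b ∈ boxes w n

-- The top-right box of (w , n) is (0 , n-1); it is the box of maximal content.
topRight : ℕ → Box
topRight n = (+ 0 , + n - + 1)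

-- Diagonal number of a box: the top-right diagonal gets n+k, the next lower
-- content n+k-1, etc.  (Diagonals of too low content get numbers ≤ 0.)
diagonalNumber : (k n : ℕ) → Box → ℤ
diagonalNumber k n b = (content b - content (topRight n)) + + (n ℕ.+ k)

Adjacent : Box → Box → Set
Adjacent (i , j) (i' , j') =
  (i ≡ i' × (j' ≡ j + + 1 ⊎ j ≡ j' + + 1)) ⊎
  (j ≡ j' × (i' ≡ i + + 1 ⊎ i ≡ i' + + 1))

data PathIn (S : Box → Set) : Box → Box → Set where
  stop : ∀ {a} → PathIn S a a
  step : ∀ {a b d} → Adjacent a b → S b → PathIn S b d → PathIn S a d

Connected : (Box → Set) → Set
Connected S = ∀ a b → S a → S b → PathIn S a b

SkewShape : (Box → Set) → Set
SkewShape S = ∀ a b x → S a → S b →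
  row a ℤ.≤ row x → row x ℤ.≤ row b → col a ℤ.≤ col x → col x ℤ.≤ col b → S x

No2x2 : (Box → Set) → Set
No2x2 S = ∀ i j → S (i , j) → S (i , j + + 1) → S (i + + 1 , j) →
  S (i + + 1 , j + + 1) → Data.Empty.⊥
  where import Data.Empty

BorderStrip : (Box → Set) → Set
BorderStrip S = Connected S × SkewShape S × No2x2 S

-- A filling of the boxes with the values 1..n+k; the value v : Fin (n+k)
-- stands for the number toℕ v + 1.  Only its values on the diagram matter.
Filling : ℕ → Set
Filling m = Box → Fin m

module _ {k : ℕ} (w : Vec Letter k) (n : ℕ) where

  StripOf : Filling (n ℕ.+ k) → Fin (n ℕ.+ k) → Box → Set
  StripOf T v b = InDiagram w n b × T b ≡ v

  IsBST : Filling (n ℕ.+ k) → Set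
  IsBST T =
    (∀ v → length (filter (λ b → T b ≟ v) (boxes w n)) ≡ n) ×
    (∀ a b → InDiagram w n a → InDiagram w n b →
       row a ≡ row b → col a ℤ.≤ col b → T a Fin.≤ T b) ×
    (∀ a b → InDiagram w n a → InDiagram w n b →
       col a ≡ col b → row a ℤ.≤ row b → T a Fin.≤ T b) ×
    (∀ v → BorderStrip (StripOf T v))

  IsHead : Filling (n ℕ.+ k) → Fin (n ℕ.+ k) → Box → Set
  IsHead T v h = StripOf T v h × (∀ b → StripOf T v b → content b ℤ.≤ content h)

  -- ψ(T) = σ : for every j, the head of the strip filled with j lies in
  -- diagonal σ(j)   (j, σ(j) ∈ Fin (n+k) stand for toℕ j + 1, toℕ σ(j) + 1)
  PsiIs : Filling (n ℕ.+ k) → Permutation′ (n ℕ.+ k) → Set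
  PsiIs T σ = ∀ j → ∃[ h ] (IsHead T j h ×
    diagonalNumber k n h ≡ + suc (toℕ (σ ⟨$⟩ʳ j)))

  BSP : Permutation′ (n ℕ.+ k) → Set
  BSP σ = ∃[ T ] (IsBST T × PsiIs T σ)

module Submission where

-- Write n = m + 1, K = m + k and N = n + k.  A box is addressed by its row X
-- and its shifted content f = content + K; the diagonal f then carries the
-- number f - m + 1, so the strip labelled j must have its head on f = σ(j) + m.
-- Every diagonal of (w , n) is a run of consecutive rows
-- [top w f , top w f + diagLen k f)  (modules Profile and Diagram), and the
-- listed boxes are pairwise distinct.
--
-- On diagonal f write, from top to bottom,
-- the labels j of the window f - m ≤ σ(j) ≤ f in increasing order.  With
-- R f τ = top w f + #{j < τ : σ(j) in the window of f}, box (X , f) gets the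
-- unique v with R f v ≤ X < R f (v+1).  The hypothesis on σ says exactly that
-- R f τ drops by 0 or 1 from f to f+1 (Windows, R-step); this gives the row and
-- column conditions, and shows that strip v is the staircase
-- {(R f v , f) : σ(v) ≤ f ≤ σ(v) + m}, a border strip with head on σ(v) + m.
--
-- In a border-strip tableau a strip meets each
-- diagonal at most once (skew shape without 2×2 squares) and, being connected
-- with n boxes and head on σ(j) + m, it meets exactly the diagonals
-- σ(j), …, σ(j) + m.  So the full diagonal f (m ≤ f ≤ m + k) carries exactly the
-- labels σ⁻¹(f - m), …, σ⁻¹(f).  Comparing the diagonals m + i and m + i + 1 box
-- by box -- along rows when w_i = c, along columns when w_i = r -- and summing,
-- the two label sets differ only in σ⁻¹(i) against σ⁻¹(n + i).

module Lists where

  open import Data.Nat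
  open import Data.Nat.Properties
  open import Data.List using (List; []; _∷_; length; _++_; [_]; applyUpTo)
  open import Data.List.Properties using (applyUpTo-∷ʳ)
  open import Data.Nat.ListAction using (sum)
  open import Data.List.Membership.Propositional using (_∈_)
  open import Data.List.Membership.Propositional.Properties using (∈-∃++)
  open import Data.List.Membership.Propositional.Properties.WithK using (unique∧set⇒bag)
  open import Data.List.Relation.Binary.BagAndSetEquality using (∼bag⇒↭)
  open import Data.Nat.ListAction.Properties using (sum-↭; sum-++)
  open import Data.List.Relation.Unary.Any using (here; there)
  import Data.List.Relation.Unary.All as All
  open import Data.List.Relation.Unary.AllPairs using (_∷_)
  open import Data.List.Relation.Unary.Unique.Propositional using (Unique)
  open import Data.Product using (_,_)
  open import Data.Empty using (⊥-elim)
  open import Relation.Nullary using (yes; no)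
  open import Relation.Binary.PropositionalEquality hiding ([_])
  open import Function.Bundles using (mk⇔)
  open import Data.List.Membership.DecPropositional using () renaming (_∈?_ to ∈?)

  ∈-delete : ∀ {A : Set} {y x : A} (as : List A) {bs : List A} →
    y ∈ as ++ x ∷ bs → y ≢ x → y ∈ as ++ bs
  ∈-delete [] (here p) ne = ⊥-elim (ne p)
  ∈-delete [] (there p) ne = p
  ∈-delete (a ∷ as) (here p) ne = here p
  ∈-delete (a ∷ as) (there p) ne = there (∈-delete as p ne)

  length-delete : ∀ {A : Set} (as : List A) {x : A} {bs : List A} →
    length (as ++ x ∷ bs) ≡ suc (length (as ++ bs))
  length-delete [] = refl
  length-delete (a ∷ as) = cong suc (length-delete as)

  unique-length-≤ : ∀ {A : Set} {xs ys : List A} → Unique xs →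
    (∀ {x} → x ∈ xs → x ∈ ys) → length xs ≤ length ys
  unique-length-≤ {xs = []} _ _ = z≤n
  unique-length-≤ {xs = x ∷ xs} (x∉xs ∷ u) sub with ∈-∃++ (sub (here refl))
  ... | as , bs , refl =
    subst (suc (length xs) ≤_) (sym (length-delete as))
      (s≤s (unique-length-≤ u (λ y∈ → ∈-delete as (sub (there y∈)) (λ y≡x → All.lookup x∉xs y∈ (sym y≡x)))))

  unique-⊆-reverse : ∀ {xs ys : List ℕ} → Unique xs → (∀ {x} → x ∈ xs → x ∈ ys) →
    length ys ≤ length xs → ∀ {y} → y ∈ ys → y ∈ xs
  unique-⊆-reverse {xs} {ys} u sub len {y} y∈ with ∈? _≟_ y xs
  ... | yes p = p
  ... | no y∉xs = ⊥-elim (<⇒≱ (unique-length-≤ (y∉xs′ ∷ u) sub′) len)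
    where
    y∉xs′ : All.All (y ≢_) xs
    y∉xs′ = All.tabulate (λ z∈ y≡z → y∉xs (subst (_∈ xs) (sym y≡z) z∈))
    sub′ : ∀ {x} → x ∈ y ∷ xs → x ∈ ys
    sub′ (here refl) = y∈
    sub′ (there p) = sub p

  unique-sum-≡ : ∀ {xs ys : List ℕ} → Unique xs → Unique ys → (∀ {x} → x ∈ xs → x ∈ ys) →
    length ys ≤ length xs → sum xs ≡ sum ys
  unique-sum-≡ ux uy sub len =
    sum-↭ (∼bag⇒↭ (unique∧set⇒bag ux uy (mk⇔ sub (unique-⊆-reverse ux sub len))))

  unique-length-≡ : ∀ {A : Set} {xs ys : List A} → Unique xs → Unique ys →
    (∀ {x} → x ∈ xs → x ∈ ys) → (∀ {x} → x ∈ ys → x ∈ xs) → length xs ≡ length ys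
  unique-length-≡ ux uy a b = ≤-antisym (unique-length-≤ ux a) (unique-length-≤ uy b)

  sumUp-snoc : ∀ (g : ℕ → ℕ) n → sum (applyUpTo g (suc n)) ≡ sum (applyUpTo g n) + g n
  sumUp-snoc g n = begin
    sum (applyUpTo g (suc n))          ≡⟨ cong sum (sym (applyUpTo-∷ʳ g n)) ⟩
    sum (applyUpTo g n ++ [ g n ])     ≡⟨ sum-++ (applyUpTo g n) [ g n ] ⟩
    sum (applyUpTo g n) + (g n + 0)    ≡⟨ cong (sum (applyUpTo g n) +_) (+-identityʳ (g n)) ⟩
    sum (applyUpTo g n) + g n          ∎
    where open ≡-Reasoning

  sumUp-cong : ∀ (g g' : ℕ → ℕ) n → (∀ j → j < n → g j ≡ g' j) → sum (applyUpTo g n) ≡ sum (applyUpTo g' n)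
  sumUp-cong g g' zero h = refl
  sumUp-cong g g' (suc n) h = cong₂ _+_ (h 0 (s≤s z≤n)) (sumUp-cong _ _ n (λ j j< → h (suc j) (s≤s j<)))

  sumUp-≤ : ∀ (g g' : ℕ → ℕ) n → (∀ j → j < n → g j ≤ g' j) → sum (applyUpTo g n) ≤ sum (applyUpTo g' n)
  sumUp-≤ g g' zero h = z≤n
  sumUp-≤ g g' (suc n) h = +-mono-≤ (h 0 (s≤s z≤n)) (sumUp-≤ _ _ n (λ j j< → h (suc j) (s≤s j<)))


module Counting where

  open import Data.Nat
  import Data.Nat.Properties as NP
  import Data.Nat.Tactic.RingSolver as NS
  open import Data.Bool using (Bool; true; false; _∧_)
  open import Data.Bool.Properties using (∧-zeroʳ)
  open import Data.Product using (_×_; _,_)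
  open import Data.Empty using (⊥-elim)
  open import Relation.Nullary using (yes; no)
  open import Relation.Binary.PropositionalEquality

  leb : ℕ → ℕ → Bool
  leb zero _ = true
  leb (suc _) zero = false
  leb (suc a) (suc b) = leb a b

  leb-t : ∀ {a b} → a ≤ b → leb a b ≡ true
  leb-t {zero} _ = refl
  leb-t {suc a} (s≤s p) = leb-t p

  leb-f : ∀ {a b} → b < a → leb a b ≡ false
  leb-f {suc a} {zero} _ = refl
  leb-f {suc a} {suc b} (s≤s p) = leb-f p

  leb-t⁻ : ∀ {a b} → leb a b ≡ true → a ≤ b
  leb-t⁻ {zero} _ = z≤n
  leb-t⁻ {suc a} {suc b} e = s≤s (leb-t⁻ e)

  ltb : ℕ → ℕ → Bool
  ltb a b = leb (suc a) b

  ltb-t : ∀ {a b} → a < b → ltb a b ≡ true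
  ltb-t = leb-t

  ltb-f : ∀ {a b} → b ≤ a → ltb a b ≡ false
  ltb-f p = leb-f (s≤s p)

  eqb : ℕ → ℕ → Bool
  eqb zero zero = true
  eqb zero (suc _) = false
  eqb (suc _) zero = false
  eqb (suc a) (suc b) = eqb a b

  eqb-t : ∀ a → eqb a a ≡ true
  eqb-t zero = refl
  eqb-t (suc a) = eqb-t a

  eqb-f : ∀ {a b} → a ≢ b → eqb a b ≡ false
  eqb-f {zero} {zero} ne = ⊥-elim (ne refl)
  eqb-f {zero} {suc b} ne = refl
  eqb-f {suc a} {zero} ne = refl
  eqb-f {suc a} {suc b} ne = eqb-f (λ e → ne (cong suc e))

  bit : Bool → ℕ
  bit true = 1
  bit false = 0

  bit≤1 : ∀ b → bit b ≤ 1
  bit≤1 true = s≤s z≤n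
  bit≤1 false = z≤n

  count : ℕ → (ℕ → Bool) → ℕ
  count zero p = 0
  count (suc j) p = bit (p 0) + count j (λ d → p (suc d))

  count-cong : ∀ j {p q : ℕ → Bool} → (∀ d → d < j → p d ≡ q d) → count j p ≡ count j q
  count-cong zero h = refl
  count-cong (suc j) h = cong₂ _+_ (cong bit (h 0 (s≤s z≤n))) (count-cong j (λ d d< → h (suc d) (s≤s d<)))

  count-false : ∀ j → count j (λ _ → false) ≡ 0
  count-false zero = refl
  count-false (suc j) = count-false j

  count-snoc : ∀ a (p : ℕ → Bool) → count (suc a) p ≡ count a p + bit (p a)
  count-snoc zero p = NP.+-identityʳ _
  count-snoc (suc a) p = trans (cong (bit (p 0) +_) (count-snoc a (λ d → p (suc d)))) (sym (NP.+-assoc (bit (p 0)) _ _))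

  count-add : ∀ a {p q s : ℕ → Bool} → (∀ d → bit (p d) ≡ bit (q d) + bit (s d)) → count a p ≡ count a q + count a s
  count-add zero h = refl
  count-add (suc a) {p} {q} {s} h = trans (cong₂ _+_ (h 0) (count-add a (λ d → h (suc d)))) (lem (bit (q 0)) (bit (s 0)) _ _)
    where
    lem : ∀ x y z u → x + y + (z + u) ≡ x + z + (y + u)
    lem = NS.solve-∀

  count-point : ∀ a s → count a (λ d → eqb d s) ≡ bit (ltb s a)
  count-point zero s = refl
  count-point (suc a) zero = cong suc (count-false a)
  count-point (suc a) (suc s) = count-point a s

  count-mono : ∀ a b (p : ℕ → Bool) → a ≤ b → count a p ≤ count b p
  count-mono a b p a≤b with NP.m≤n⇒∃[o]m+o≡n a≤b
  ... | o , refl = go o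
    where
    go : ∀ o → count a p ≤ count (a + o) p
    go zero = NP.≤-reflexive (cong (λ z → count z p) (sym (NP.+-identityʳ a)))
    go (suc o) = NP.≤-trans (go o) (subst (count (a + o) p ≤_) (trans (sym (count-snoc (a + o) p)) (cong (λ z → count z p) (sym (NP.+-suc a o)))) (NP.m≤m+n _ _))

  count-threshold : ∀ N (p : ℕ → Bool) v → v ≤ N → (∀ t → t < N → p t ≡ ltb t v) → count N p ≡ v
  count-threshold zero p zero _ _ = refl
  count-threshold (suc N) p zero _ h = trans (cong₂ _+_ (cong bit (h 0 (s≤s z≤n))) (count-cong N (λ d d< → h (suc d) (s≤s d<)))) (count-false N)
  count-threshold (suc N) p (suc v) (s≤s v≤) h = trans (cong₂ _+_ (cong bit (h 0 (s≤s z≤n))) refl)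
    (cong suc (count-threshold N (λ d → p (suc d)) v v≤ (λ t t< → h (suc t) (s≤s t<))))

  window : ℕ → ℕ → ℕ → Bool
  window lo hi d = leb lo d ∧ leb d hi

  count-window : ∀ N lo hi → count N (window lo hi) ≡ (suc hi ⊓ N) ∸ lo
  count-window zero lo hi = sym (NP.0∸n≡0 lo)
  count-window (suc N) zero zero = cong suc (trans (count-cong N (λ d _ → ∧-zeroʳ (leb 0 (suc d)))) (count-false N))
  count-window (suc N) (suc lo) zero = trans (count-cong N (λ d _ → ∧-zeroʳ (leb (suc lo) (suc d)))) (trans (count-false N) (sym (NP.0∸n≡0 lo)))
  count-window (suc N) zero (suc hi) = cong suc (count-window N zero hi)
  count-window (suc N) (suc lo) (suc hi) = count-window N lo hi

  window-split : ∀ s lo f → lo ≤ suc f → bit (ltb s (suc f)) ≡ bit (ltb s lo) + bit (window lo f s)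
  window-split s lo f lo≤ with s <? lo | s ≤? f
  ... | yes p | yes q rewrite ltb-t (s≤s q) | ltb-t p | leb-f p = refl
  ... | yes p | no q = ⊥-elim (q (NP.≤-pred (NP.≤-trans p lo≤)))
  ... | no p | yes q rewrite ltb-t (s≤s q) | ltb-f (NP.≮⇒≥ p) | leb-t (NP.≮⇒≥ p) = refl
  ... | no p | no q rewrite ltb-f {s} {suc f} (NP.≰⇒> q) | ltb-f (NP.≮⇒≥ p) | leb-t (NP.≮⇒≥ p) = refl

  step-bounds : ∀ {Rf R1 A B x y} → Rf + A ≡ B + x → R1 + A ≡ B + y → y ≤ x → x ≤ suc y → R1 ≤ Rf × Rf ≤ suc R1
  step-bounds {Rf} {R1} {A} {B} {x} {y} e1 e2 yx xy =
    NP.+-cancelʳ-≤ x R1 Rf (subst (_≤ Rf + x) swap (NP.+-monoʳ-≤ Rf yx)) ,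
    NP.+-cancelʳ-≤ y Rf (suc R1) (subst (Rf + y ≤_) (NP.+-suc R1 y) (subst (_≤ R1 + suc y) (sym swap) (NP.+-monoʳ-≤ R1 xy)))
    where
    open ≡-Reasoning
    lem : ∀ a b c → a + b + c ≡ a + c + b
    lem = NS.solve-∀
    swap : Rf + y ≡ R1 + x
    swap = NP.+-cancelʳ-≡ A (Rf + y) (R1 + x) (begin
      Rf + y + A  ≡⟨ lem Rf y A ⟩
      Rf + A + y  ≡⟨ cong (_+ y) e1 ⟩
      B + x + y   ≡⟨ lem B x y ⟩
      B + y + x   ≡⟨ cong (_+ x) (sym e2) ⟩
      R1 + A + x  ≡⟨ lem R1 A x ⟩
      R1 + x + A  ∎)


module Profile where

  open import Data.Nat
  open import Data.Nat.Properties
  open import Data.Fin as Fin using (Fin; toℕ)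
  open import Data.Vec using (Vec; []; _∷_; lookup; toList)
  open import Data.List as List using (List; []; _∷_; drop)
  open import Data.Product using (_×_; _,_)
  open import Relation.Binary.PropositionalEquality
  open import Defs
  open Counting
  import Data.Vec.Properties as VP

  isRow : Letter → ℕ
  isRow r = 1
  isRow c = 0

  rCount : List Letter → ℕ
  rCount [] = 0
  rCount (x ∷ xs) = isRow x + rCount xs

  drop-lookup : ∀ {k} (w : Vec Letter k) (i : Fin k) →
    rCount (drop (toℕ i) (toList w)) ≡ isRow (lookup w i) + rCount (drop (suc (toℕ i)) (toList w))
  drop-lookup (x ∷ w) Fin.zero = refl
  drop-lookup (x ∷ w) (Fin.suc i) = drop-lookup w i

  drop-all : ∀ (xs : List Letter) j → List.length xs ≤ j → rCount (drop j xs) ≡ 0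
  drop-all [] zero _ = refl
  drop-all [] (suc j) _ = refl
  drop-all (x ∷ xs) (suc j) (s≤s p) = drop-all xs j p

  m∸[m+n]≡0 : ∀ a b → a ∸ (a + b) ≡ 0
  m∸[m+n]≡0 a b = m≤n⇒m∸n≡0 (m≤m+n a b)

  module Shape (m : ℕ) where

    -- Row of the topmost box on the diagonal of shifted content f: the square
    -- contributes m - f, and each r among the letters w_{f-m}, w_{f-m+1}, …
    -- pushes the diagonal one row down.
    top : ∀ {k} → Vec Letter k → ℕ → ℕ
    top w f = (m ∸ f) + rCount (drop (f ∸ m) (toList w))

    diagLen : ℕ → ℕ → ℕ
    diagLen k f = count (suc (m + k)) (window (f ∸ m) f)

    box : ℕ → ℕ → ℕ → Box
    box k X f = (ℤ.+ X , ℤ.+ (X + f) ℤ.- ℤ.+ (m + k))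
      where import Data.Integer as ℤ

    OnDiag : ∀ {k} → Vec Letter k → ℕ → ℕ → Set
    OnDiag {k} w X f = top w f ≤ X × X < top w f + diagLen k f

    top-lt : ∀ {k} (w : Vec Letter k) f → f < m → top w f ≡ suc (top w (suc f))
    top-lt w f f<m rewrite m≤n⇒m∸n≡0 (<⇒≤ f<m) | m≤n⇒m∸n≡0 f<m | +-∸-assoc 1 f<m = refl

    top-mid : ∀ {k} (w : Vec Letter k) (i : Fin k) →
      top w (m + toℕ i) ≡ isRow (lookup w i) + top w (suc (m + toℕ i))
    top-mid w i = begin
      top w (m + I)
        ≡⟨ cong₂ (λ a b → a + rCount (drop b (toList w))) (m∸[m+n]≡0 m I) (m+n∸m≡n m I) ⟩
      rCount (drop I (toList w))
        ≡⟨ drop-lookup w i ⟩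
      isRow (lookup w i) + rCount (drop (suc I) (toList w))
        ≡⟨ cong (isRow (lookup w i) +_) (sym next) ⟩
      isRow (lookup w i) + top w (suc (m + I)) ∎
      where
      open ≡-Reasoning
      I : ℕ
      I = toℕ i
      next : top w (suc (m + I)) ≡ rCount (drop (suc I) (toList w))
      next = cong₂ (λ a b → a + rCount (drop b (toList w)))
        (m≤n⇒m∸n≡0 (≤-trans (m≤m+n m I) (n≤1+n _)))
        (trans (cong (_∸ m) (sym (+-suc m I))) (m+n∸m≡n m (suc I)))

    top-hi : ∀ {k} (w : Vec Letter k) f → m + k ≤ f → top w f ≡ 0
    top-hi {k} w f p rewrite m≤n⇒m∸n≡0 (≤-trans (m≤m+n m k) p) =
      drop-all (toList w) (f ∸ m) (subst (_≤ f ∸ m) (sym (VP.length-toList w)) (subst (_≤ f ∸ m) (m+n∸m≡n m k) (∸-monoˡ-≤ m p)))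


module Diagram where

  open import Data.Nat as ℕ using (ℕ; zero; suc; z≤n; s≤s; _≤_; _<_; _∸_; _⊓_; _≤?_)
  import Data.Nat.Properties as NP
  import Data.Nat.Tactic.RingSolver as NS
  open import Data.Integer as ℤ using (ℤ; +_; _-_; _+_)
  import Data.Integer.Properties as ZP
  open import Data.Integer.Tactic.RingSolver
  open import Data.Vec using (Vec; []; _∷_; toList)
  open import Data.List using ([]; _∷_; upTo; map; _++_)
  open import Data.List.Membership.Propositional using (_∈_; find)
  open import Data.List.Membership.Propositional.Properties using (∈-++⁻; ∈-++⁺ˡ; ∈-++⁺ʳ; ∈-map⁻; ∈-map⁺; ∈-upTo⁻; ∈-upTo⁺; ∈-concatMap⁻; ∈-concatMap⁺)
  import Data.List.Relation.Unary.Any as Any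
  open import Data.List.Relation.Unary.Unique.Propositional using (Unique)
  import Data.List.Relation.Unary.Unique.Propositional.Properties as UP
  import Data.List.Relation.Unary.AllPairs as AllPairs
  import Data.List.Relation.Unary.AllPairs.Properties as APP
  import Data.List.Relation.Unary.All as All
  import Data.List.Relation.Unary.All.Properties as AllP
  open import Data.Product using (_×_; _,_; proj₁; proj₂; ∃; ∃₂)
  open import Data.Sum using (inj₁; inj₂)
  open import Relation.Nullary using (¬_; yes; no)
  open import Relation.Binary.PropositionalEquality
  open import Defs
  open Counting
  open Profile

  rCountV : ∀ {k} → Vec Letter k → ℕ
  rCountV w = rCount (toList w)

  <∸⇒+< : ∀ a b q → a < b ∸ q → a ℕ.+ q < b
  <∸⇒+< a b zero p = subst (_< b) (sym (NP.+-identityʳ a)) p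
  <∸⇒+< a zero (suc q) ()
  <∸⇒+< a (suc b) (suc q) p = subst (_< suc b) (sym (NP.+-suc a q)) (s≤s (<∸⇒+< a b q p))

  suc-sub-suc : ∀ a b → + suc a - + suc b ≡ + a - + b
  suc-sub-suc a b = trans (cong₂ _-_ (ZP.pos-+ 1 a) (ZP.pos-+ 1 b)) (lem (+ a) (+ b))
    where
    lem : ∀ (x y : ℤ) → + 1 + x - (+ 1 + y) ≡ x - y
    lem = solve-∀

  sub-add : ∀ (x a : ℤ) → x - a + a ≡ x
  sub-add = solve-∀

  add-sub : ∀ (x a : ℤ) → x + a - a ≡ x
  add-sub = solve-∀

  +-cancelʳ-ℤ : ∀ {a x y : ℤ} → x + a ≡ y + a → x ≡ y
  +-cancelʳ-ℤ {a} {x} {y} e = trans (sym (add-sub x a)) (trans (cong (_- a) e) (add-sub y a))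

  +-cancelˡ-ℤ : ∀ {a x y : ℤ} → a + x ≡ a + y → x ≡ y
  +-cancelˡ-ℤ {a} {x} {y} e = +-cancelʳ-ℤ {a} (trans (ZP.+-comm x a) (trans e (ZP.+-comm a y)))

  sub-cancelʳ-ℤ : ∀ {a x y : ℤ} → x - a ≡ y - a → x ≡ y
  sub-cancelʳ-ℤ {a} {x} {y} e = trans (sym (sub-add x a)) (trans (cong (_+ a) e) (sub-add y a))

  sub-cancel-≤ℤ : ∀ {x y K : ℤ} → x - K ℤ.≤ y - K → x ℤ.≤ y
  sub-cancel-≤ℤ {x} {y} {K} p = subst₂ ℤ._≤_ (sub-add x K) (sub-add y K) (ZP.+-monoˡ-≤ K p)

  ℤ-between-ℕ : ∀ {a b : ℕ} {y : ℤ} → + a ℤ.≤ y → y ℤ.≤ + b → ∃ λ z → y ≡ + z × a ≤ z × z ≤ b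
  ℤ-between-ℕ {y = + z} (ℤ.+≤+ p) (ℤ.+≤+ q) = z , refl , p , q

  module Geometry (m : ℕ) where
    open Shape m

    bottomRow≡ : ∀ {k} (w : Vec Letter k) → bottomRow (suc m) w ≡ + (m ℕ.+ rCountV w)
    bottomRow≡ [] = trans (cong (_- + 1) (ZP.pos-+ 1 m)) (trans (lem (+ m)) (sym (cong +_ (NP.+-identityʳ m))))
      where
      lem : ∀ (a : ℤ) → + 1 + a - + 1 ≡ a
      lem = solve-∀
    bottomRow≡ (c ∷ w) = bottomRow≡ w
    bottomRow≡ (r ∷ w) = trans (cong (_+ + 1) (bottomRow≡ w)) (trans (lem (+ m) (+ rCountV w)) (sym (trans (ZP.pos-+ m (suc (rCountV w))) (cong (λ z → + m + z) (ZP.pos-+ 1 (rCountV w))))))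
      where
      lem : ∀ (a b : ℤ) → a + b + + 1 ≡ a + (+ 1 + b)
      lem = solve-∀

    leftCol≡ : ∀ {k} (w : Vec Letter k) → leftCol w ≡ + rCountV w - + k
    leftCol≡ [] = refl
    leftCol≡ {suc k} (c ∷ w) = trans (cong (_- + 1) (leftCol≡ w)) (trans (lem (+ rCountV w) (+ k)) (cong (λ z → + rCountV w - z) (sym (ZP.pos-+ 1 k))))
      where
      lem : ∀ (a b : ℤ) → a - b - + 1 ≡ a - (+ 1 + b)
      lem = solve-∀
    leftCol≡ {suc k} (r ∷ w) = trans (leftCol≡ w) (trans (lem (+ rCountV w) (+ k)) (cong₂ (λ y z → y - z) (sym (ZP.pos-+ 1 (rCountV w))) (sym (ZP.pos-+ 1 k))))
      where
      lem : ∀ (a b : ℤ) → a - b ≡ (+ 1 + a) - (+ 1 + b)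
      lem = solve-∀

    -- Behaviour of top when a letter is prepended to the word: the diagonal f of w
    -- becomes the diagonal f + 1 of x w, and the diagonal 0 of x w is its corner box.
    top-zero : ∀ {k} x (w : Vec Letter k) → top (x ∷ w) 0 ≡ m ℕ.+ rCountV (x ∷ w)
    top-zero x w rewrite NP.0∸n≡0 m = refl

    top-small : ∀ {k} (w : Vec Letter k) f → f ≤ m → top w f ≡ (m ∸ f) ℕ.+ rCountV w
    top-small w f p rewrite NP.m≤n⇒m∸n≡0 p = refl

    -- For f < m the prepended letter x lengthens the diagonal by one box, at its
    -- top for x = c and at its bottom for x = r.
    top-cons-lt : ∀ {k} x (w : Vec Letter k) f → f < m → suc (top (x ∷ w) (suc f)) ≡ top w f ℕ.+ isRow x
    top-cons-lt x w f p rewrite top-small (x ∷ w) (suc f) p | top-small w f (NP.<⇒≤ p) | NP.+-∸-assoc 1 p =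
      lem (m ∸ suc f) (isRow x) (rCountV w)
      where
      lem : ∀ a b c → suc (a ℕ.+ (b ℕ.+ c)) ≡ suc a ℕ.+ c ℕ.+ b
      lem = NS.solve-∀

    top-cons-ge : ∀ {k} x (w : Vec Letter k) f → m ≤ f → top (x ∷ w) (suc f) ≡ top w f
    top-cons-ge x w f p rewrite NP.m≤n⇒m∸n≡0 (NP.≤-trans p (NP.n≤1+n f)) | NP.m≤n⇒m∸n≡0 p | NP.+-∸-assoc 1 p = refl

    top-cons-r : ∀ {k} (w : Vec Letter k) f → top (r ∷ w) (suc f) ≡ top w f
    top-cons-r w f with f ℕ.<? m
    ... | yes p = NP.suc-injective (trans (top-cons-lt r w f p) (NP.+-comm (top w f) 1))
    ... | no p = top-cons-ge r w f (NP.≮⇒≥ p)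

    L-small : ∀ k f → f ≤ m → diagLen k f ≡ suc f
    L-small k f p = trans (count-window (suc (m ℕ.+ k)) (f ∸ m) f)
      (trans (cong₂ _∸_ (NP.m≤n⇒m⊓n≡m (s≤s (NP.≤-trans p (NP.m≤m+n m k)))) (NP.m≤n⇒m∸n≡0 p)) refl)

    L-cons-ge : ∀ k f → m ≤ f → diagLen (suc k) (suc f) ≡ diagLen k f
    L-cons-ge k f p = trans (count-window (suc (m ℕ.+ suc k)) (suc f ∸ m) (suc f))
      (trans (cong₂ (λ a b → (suc (suc f) ⊓ suc a) ∸ b) (NP.+-suc m k) (NP.+-∸-assoc 1 p))
      (sym (count-window (suc (m ℕ.+ k)) (f ∸ m) f)))

    L-cons-lt : ∀ k f → f < m → diagLen (suc k) (suc f) ≡ suc (diagLen k f)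
    L-cons-lt k f p = trans (L-small (suc k) (suc f) p) (cong suc (sym (L-small k f (NP.<⇒≤ p))))

    -- For f ≤ m the diagonal f starts in the leftmost column of (w , m+1) …
    top-small+ : ∀ {k} (w : Vec Letter k) f → f ≤ m → top w f ℕ.+ f ≡ m ℕ.+ rCountV w
    top-small+ w f p = begin
      top w f ℕ.+ f                ≡⟨ cong (ℕ._+ f) (top-small w f p) ⟩
      m ∸ f ℕ.+ rCountV w ℕ.+ f    ≡⟨ swap (m ∸ f) (rCountV w) f ⟩
      m ∸ f ℕ.+ f ℕ.+ rCountV w    ≡⟨ cong (ℕ._+ rCountV w) (NP.m∸n+n≡m p) ⟩
      m ℕ.+ rCountV w              ∎
      where
      open ≡-Reasoning
      swap : ∀ a b c → a ℕ.+ b ℕ.+ c ≡ a ℕ.+ c ℕ.+ b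
      swap = NS.solve-∀

    -- … and for f ≤ m it ends in the bottom row m + #r(w) of (w , m+1).
    run-end-small : ∀ {k} (w : Vec Letter k) f → f ≤ m → top w f ℕ.+ diagLen k f ≡ suc (m ℕ.+ rCountV w)
    run-end-small {k} w f p =
      trans (cong (top w f ℕ.+_) (L-small k f p)) (trans (NP.+-suc _ f) (cong suc (top-small+ w f p)))

    content-box : ∀ {k} X f → content (box k X f) ≡ + f - + (m ℕ.+ k)
    content-box {k} X f = trans (cong (λ z → z - + (m ℕ.+ k) - + X) (ZP.pos-+ X f)) (l (+ X) (+ f) (+ (m ℕ.+ k)))
      where
      l : ∀ (a b d : ℤ) → a + b - d - a ≡ b - d
      l = solve-∀

    diagonalNumber-content : ∀ k b → diagonalNumber k (suc m) b ≡ content b + + suc k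
    diagonalNumber-content k b = begin
      (content b - ((+ suc m - + 1) - + 0)) + + suc (m ℕ.+ k)
        ≡⟨ cong₂ (λ x y → (content b - ((x - + 1) - + 0)) + y) (ZP.pos-+ 1 m) (trans (ZP.pos-+ 1 (m ℕ.+ k)) (cong (λ z → + 1 + z) (ZP.pos-+ m k))) ⟩
      (content b - ((+ 1 + + m - + 1) - + 0)) + (+ 1 + (+ m + + k))
        ≡⟨ l (content b) (+ m) (+ k) ⟩
      content b + (+ 1 + + k)
        ≡⟨ cong (λ z → content b + z) (sym (ZP.pos-+ 1 k)) ⟩
      content b + + suc k ∎
      where
      open ≡-Reasoning
      l : ∀ (x a b : ℤ) → (x - ((+ 1 + a - + 1) - + 0)) + (+ 1 + (a + b)) ≡ x + (+ 1 + b)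
      l = solve-∀

    head-diagonal : ∀ k h → + (h ℕ.+ m) - + (m ℕ.+ k) + + suc k ≡ + suc h
    head-diagonal k h = begin
      + (h ℕ.+ m) - + (m ℕ.+ k) + + suc k   ≡⟨ cong₂ (λ x y → x - y + + suc k) (ZP.pos-+ h m) (ZP.pos-+ m k) ⟩
      + h + + m - (+ m + + k) + + suc k     ≡⟨ cong (λ z → + h + + m - (+ m + + k) + z) (ZP.pos-+ 1 k) ⟩
      + h + + m - (+ m + + k) + (+ 1 + + k) ≡⟨ l (+ h) (+ m) (+ k) ⟩
      + 1 + + h                             ≡⟨ sym (ZP.pos-+ 1 h) ⟩
      + suc h                               ∎
      where
      open ≡-Reasoning
      l : ∀ (a b d : ℤ) → a + b - (b + d) + (+ 1 + d) ≡ + 1 + a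
      l = solve-∀

    box-cons : ∀ k X f → box (suc k) X (suc f) ≡ box k X f
    box-cons k X f = cong (+ X ,_) (trans (cong₂ (λ a b → + a - + b) (NP.+-suc X f) (NP.+-suc m k)) (suc-sub-suc (X ℕ.+ f) (m ℕ.+ k)))

    top-nil : ∀ f → top [] f ≡ m ∸ f
    top-nil f = trans (cong ((m ∸ f) ℕ.+_) (drop-all [] (f ∸ m) z≤n)) (NP.+-identityʳ _)

    square⇒OnDiag : ∀ X f → X ≤ m → m ≤ X ℕ.+ f → X ℕ.+ f ≤ m ℕ.+ m → OnDiag [] X f
    square⇒OnDiag X f a b d with f ≤? m
    ... | yes p = subst (_≤ X) (sym (top-nil f)) (NP.m≤n+o⇒m∸n≤o m f (subst (m ≤_) (NP.+-comm X f) b)) ,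
                  subst₂ (λ u v → X < u ℕ.+ v) (sym (top-nil f)) (sym (L-small 0 f p))
                    (subst (X <_) (sym (trans (NP.+-suc (m ∸ f) f) (cong suc (NP.m∸n+n≡m p)))) (s≤s a))
    ... | no p = subst (_≤ X) (sym (top-nil f)) (subst (_≤ X) (sym (NP.m≤n⇒m∸n≡0 (NP.<⇒≤ (NP.≰⇒> p)))) z≤n) ,
                 subst (X <_) (sym (cong₂ ℕ._+_ (top-nil f) refl))
                   (subst (λ u → X < u) (sym (trans (cong (ℕ._+ diagLen 0 f) (NP.m≤n⇒m∸n≡0 (NP.<⇒≤ (NP.≰⇒> p)))) refl))
                     (subst (X <_) (sym (trans (count-window (suc (m ℕ.+ 0)) (f ∸ m) f)
                          (cong (_∸ (f ∸ m)) (NP.m≥n⇒m⊓n≡n (s≤s (subst (_≤ f) (sym (NP.+-identityʳ m)) (NP.<⇒≤ (NP.≰⇒> p))))))))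
                       (NP.m+n≤o⇒m≤o∸n (suc X) (s≤s (subst (_≤ m ℕ.+ 0) (refl) key)))))
      where
      mf : m ≤ f
      mf = NP.<⇒≤ (NP.≰⇒> p)
      key : X ℕ.+ (f ∸ m) ≤ m ℕ.+ 0
      key = subst (X ℕ.+ (f ∸ m) ≤_) (sym (NP.+-identityʳ m))
             (NP.+-cancelʳ-≤ m (X ℕ.+ (f ∸ m)) m
               (subst (_≤ m ℕ.+ m) (sym (trans (NP.+-assoc X (f ∸ m) m) (cong (X ℕ.+_) (NP.m∸n+n≡m mf)))) d))

    OnDiag⇒square : ∀ X f → OnDiag [] X f → X ≤ m × m ≤ X ℕ.+ f × X ℕ.+ f ≤ m ℕ.+ m
    OnDiag⇒square X f (lo , hi) with f ≤? m
    ... | yes p = xm , subst (m ≤_) (NP.+-comm f X) (NP.≤-trans (NP.m≤n+m∸n m f) (NP.+-monoʳ-≤ f lo')) , NP.+-mono-≤ xm p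
      where
      lo' : m ∸ f ≤ X
      lo' = subst (_≤ X) (top-nil f) lo
      xm : X ≤ m
      xm = NP.≤-pred (subst (X <_) (trans (cong₂ ℕ._+_ (top-nil f) (L-small 0 f p)) (trans (NP.+-suc (m ∸ f) f) (cong suc (NP.m∸n+n≡m p)))) hi)
    ... | no p = NP.≤-trans (NP.m≤m+n X (f ∸ m)) k2 , NP.≤-trans mf (NP.m≤n+m f X) ,
                 subst (_≤ m ℕ.+ m) (trans (NP.+-assoc X (f ∸ m) m) (cong (X ℕ.+_) (NP.m∸n+n≡m mf))) (NP.+-monoˡ-≤ m k2)
      where
      mf : m ≤ f
      mf = NP.<⇒≤ (NP.≰⇒> p)
      hi' : X < suc m ∸ (f ∸ m)
      hi' = subst (X <_) (trans (cong₂ ℕ._+_ (trans (top-nil f) (NP.m≤n⇒m∸n≡0 mf)) (count-window (suc (m ℕ.+ 0)) (f ∸ m) f))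
              (cong (_∸ (f ∸ m)) (trans (NP.m≥n⇒m⊓n≡n (s≤s (subst (_≤ f) (sym (NP.+-identityʳ m)) mf))) (cong suc (NP.+-identityʳ m))))) hi
      k2 : X ℕ.+ (f ∸ m) ≤ m
      k2 = NP.≤-pred (<∸⇒+< X (suc m) (f ∸ m) hi')

    ∈square⇒ : ∀ {b} → b ∈ boxes [] (suc m) → ∃₂ λ i j → i ≤ m × j ≤ m × b ≡ (+ i , + j)
    ∈square⇒ {b} p with find (∈-concatMap⁻ (λ i → map (λ j → (+ i , + j)) (upTo (suc m))) {xs = upTo (suc m)} p)
    ... | i , i∈ , q with ∈-map⁻ (λ j → (+ i , + j)) q
    ... | j , j∈ , eq = i , j , NP.≤-pred (∈-upTo⁻ i∈) , NP.≤-pred (∈-upTo⁻ j∈) , eq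

    ∈square⇐ : ∀ i j → i ≤ m → j ≤ m → (+ i , + j) ∈ boxes [] (suc m)
    ∈square⇐ i j p q = ∈-concatMap⁺ (λ i → map (λ j → (+ i , + j)) (upTo (suc m)))
      (Any.map (λ { refl → ∈-map⁺ (λ j → (+ i , + j)) (∈-upTo⁺ (s≤s q)) }) (∈-upTo⁺ {suc m} {i} (s≤s p)))

    box-square : ∀ X f j → X ℕ.+ f ≡ m ℕ.+ j → box 0 X f ≡ (+ X , + j)
    box-square X f j e = cong (+ X ,_) (trans (cong₂ (λ a b → + a - + b) e (NP.+-identityʳ m))
                     (trans (cong (_- + m) (ZP.pos-+ m j)) (lem (+ m) (+ j))))
      where
      lem : ∀ (a b : ℤ) → a + b - a ≡ b
      lem = solve-∀

    newColumn≡box : ∀ {k} (w : Vec Letter k) t X f → X ≡ rCountV w ℕ.+ t → X ℕ.+ f ≡ m ℕ.+ rCountV w →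
      (bottomRow (suc m) w - + suc m + + 1 + + t , leftCol w - + 1) ≡ box (suc k) X f
    newColumn≡box {k} w t X f e1 e2 rewrite bottomRow≡ w | leftCol≡ w =
      cong₂ _,_ (trans (cong (λ z → z - + suc m + + 1 + + t) (ZP.pos-+ m (rCountV w)))
                   (trans (cong (λ z → + m + + rCountV w - z + + 1 + + t) (ZP.pos-+ 1 m))
                   (trans (l1 (+ m) (+ rCountV w) (+ t)) (trans (sym (ZP.pos-+ (rCountV w) t)) (cong +_ (sym e1))))))
                (sym (trans (cong₂ (λ a b → + a - + b) e2 (NP.+-suc m k))
                   (trans (cong₂ (λ a b → a - b) (ZP.pos-+ m (rCountV w)) (ZP.pos-+ 1 (m ℕ.+ k)))
                   (trans (cong (λ z → + m + + rCountV w - (+ 1 + z)) (ZP.pos-+ m k)) (l2 (+ m) (+ rCountV w) (+ k))))))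
      where
      l1 : ∀ (a b d : ℤ) → a + b - (+ 1 + a) + + 1 + d ≡ b + d
      l1 = solve-∀
      l2 : ∀ (a b d : ℤ) → a + b - (+ 1 + (a + d)) ≡ b - d - + 1
      l2 = solve-∀

    newRow≡box : ∀ {k} (w : Vec Letter k) t X → X ≡ suc (m ℕ.+ rCountV w) →
      (bottomRow (suc m) w + + 1 , leftCol w + + t) ≡ box (suc k) X t
    newRow≡box {k} w t X e rewrite bottomRow≡ w | leftCol≡ w | e =
      cong₂ _,_ (trans (cong (_+ + 1) (ZP.pos-+ m (rCountV w))) (trans (l1 (+ m) (+ rCountV w)) (sym (trans (ZP.pos-+ 1 (m ℕ.+ rCountV w)) (cong (λ z → + 1 + z) (ZP.pos-+ m (rCountV w)))))))
        (sym (trans (cong₂ (λ a b → + a - + b) refl (NP.+-suc m k))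
          (trans (cong₂ (λ a b → a - b) (trans (ZP.pos-+ 1 (m ℕ.+ rCountV w ℕ.+ t)) (cong (λ z → + 1 + z) (trans (ZP.pos-+ (m ℕ.+ rCountV w) t) (cong (_+ + t) (ZP.pos-+ m (rCountV w)))))) (trans (ZP.pos-+ 1 (m ℕ.+ k)) (cong (λ z → + 1 + z) (ZP.pos-+ m k))))
            (l2 (+ m) (+ rCountV w) (+ t) (+ k)))))
      where
      l1 : ∀ (a b : ℤ) → a + b + + 1 ≡ + 1 + (a + b)
      l1 = solve-∀
      l2 : ∀ (a b d e : ℤ) → + 1 + (a + b + d) - (+ 1 + (a + e)) ≡ b - e + d
      l2 = solve-∀

    newColumn : ∀ {k} → Vec Letter k → ℕ → Box
    newColumn w t = (bottomRow (suc m) w - + suc m + + 1 + + t , leftCol w - + 1)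

    newRow : ∀ {k} → Vec Letter k → ℕ → Box
    newRow w t = (bottomRow (suc m) w + + 1 , leftCol w + + t)

    OnDiag-cons-c : ∀ {k} (w : Vec Letter k) X f → OnDiag w X f → OnDiag (c ∷ w) X (suc f)
    OnDiag-cons-c {k} w X f (lo , hi) with f ℕ.<? m
    ... | yes p = NP.≤-trans (NP.n≤1+n _) (subst (_≤ X) (sym st) lo) ,
                  subst (X <_) (trans (cong (ℕ._+ diagLen k f) (sym st)) (trans (sym (NP.+-suc _ _)) (cong (top (c ∷ w) (suc f) ℕ.+_) (sym (L-cons-lt k f p)))))
                    hi
      where
      st : suc (top (c ∷ w) (suc f)) ≡ top w f
      st = trans (top-cons-lt c w f p) (NP.+-identityʳ _)
    ... | no p = subst (_≤ X) (sym (top-cons-ge c w f (NP.≮⇒≥ p))) lo ,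
                 subst (X <_) (cong₂ ℕ._+_ (sym (top-cons-ge c w f (NP.≮⇒≥ p))) (sym (L-cons-ge k f (NP.≮⇒≥ p)))) hi

    OnDiag-cons-r : ∀ {k} (w : Vec Letter k) X f → OnDiag w X f → OnDiag (r ∷ w) X (suc f)
    OnDiag-cons-r {k} w X f (lo , hi) = subst (_≤ X) (sym (top-cons-r w f)) lo ,
      NP.<-≤-trans hi (NP.+-mono-≤ (NP.≤-reflexive (sym (top-cons-r w f))) Lle)
      where
      Lle : diagLen k f ≤ diagLen (suc k) (suc f)
      Lle with f ℕ.<? m
      ... | yes p = NP.≤-trans (NP.n≤1+n _) (NP.≤-reflexive (sym (L-cons-lt k f p)))
      ... | no p = NP.≤-reflexive (sym (L-cons-ge k f (NP.≮⇒≥ p)))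

    -- The t-th box of the added column lies on diagonal m - t of c w.
    newColumn-diag : ∀ {k} (w : Vec Letter k) t → t ≤ m → rCountV w ℕ.+ t ℕ.+ (m ∸ t) ≡ m ℕ.+ rCountV w
    newColumn-diag w t tm = trans (NP.+-assoc (rCountV w) t (m ∸ t)) (trans (cong (rCountV w ℕ.+_) (NP.m+[n∸m]≡n tm)) (NP.+-comm (rCountV w) m))

    newColumn-OnDiag : ∀ {k} (w : Vec Letter k) t → t ≤ m →
      newColumn w t ≡ box (suc k) (rCountV w ℕ.+ t) (m ∸ t) × OnDiag (c ∷ w) (rCountV w ℕ.+ t) (m ∸ t)
    newColumn-OnDiag {k} w t tm = newColumn≡box w t _ _ refl (newColumn-diag w t tm) , lo , hi
      where
      tp : top (c ∷ w) (m ∸ t) ≡ t ℕ.+ rCountV w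
      tp = trans (top-small (c ∷ w) (m ∸ t) (NP.m∸n≤m m t)) (cong (ℕ._+ rCountV w) (NP.m∸[m∸n]≡n tm))
      lo : top (c ∷ w) (m ∸ t) ≤ rCountV w ℕ.+ t
      lo = NP.≤-reflexive (trans tp (NP.+-comm t (rCountV w)))
      hi : rCountV w ℕ.+ t < top (c ∷ w) (m ∸ t) ℕ.+ diagLen (suc k) (m ∸ t)
      hi = subst (rCountV w ℕ.+ t <_) (sym (cong₂ ℕ._+_ tp (L-small (suc k) (m ∸ t) (NP.m∸n≤m m t))))
            (subst (_< t ℕ.+ rCountV w ℕ.+ suc (m ∸ t)) (NP.+-comm t (rCountV w))
              (subst (t ℕ.+ rCountV w <_) (sym (NP.+-suc _ _)) (s≤s (NP.m≤m+n _ _))))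

    newRow-OnDiag : ∀ {k} (w : Vec Letter k) t → t ≤ m →
      newRow w t ≡ box (suc k) (suc (m ℕ.+ rCountV w)) t × OnDiag (r ∷ w) (suc (m ℕ.+ rCountV w)) t
    newRow-OnDiag {k} w t tm = newRow≡box w t _ refl , lo , hi
      where
      lo : top (r ∷ w) t ≤ suc (m ℕ.+ rCountV w)
      lo = subst (_≤ suc (m ℕ.+ rCountV w)) (sym (top-small (r ∷ w) t tm))
             (subst (_≤ suc (m ℕ.+ rCountV w)) (sym (NP.+-suc _ _)) (s≤s (NP.+-monoˡ-≤ (rCountV w) (NP.m∸n≤m m t))))
      hi : suc (m ℕ.+ rCountV w) < top (r ∷ w) t ℕ.+ diagLen (suc k) t
      hi = subst (suc (m ℕ.+ rCountV w) <_) (sym (trans (run-end-small (r ∷ w) t tm) (cong suc (NP.+-suc m _)))) NP.≤-refl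

    ∈boxes⇒OnDiag : ∀ {k} (w : Vec Letter k) {b} → b ∈ boxes w (suc m) → ∃₂ λ X f → b ≡ box k X f × OnDiag w X f
    ∈boxes⇒OnDiag [] p with ∈square⇒ p
    ... | i , j , im , jm , refl =
      i , (m ∸ i) ℕ.+ j , sym (box-square i ((m ∸ i) ℕ.+ j) j e) ,
      square⇒OnDiag i _ im (subst (m ≤_) (sym e) (NP.m≤m+n m j)) (subst (ℕ._≤ m ℕ.+ m) (sym e) (NP.+-monoʳ-≤ m jm))
      where
      e : i ℕ.+ ((m ∸ i) ℕ.+ j) ≡ m ℕ.+ j
      e = trans (sym (NP.+-assoc i (m ∸ i) j)) (cong (ℕ._+ j) (NP.m+[n∸m]≡n im))
    ∈boxes⇒OnDiag {suc k} (c ∷ w) {b} p with ∈-++⁻ (boxes w (suc m)) p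
    ... | inj₁ q with ∈boxes⇒OnDiag w q
    ...   | X , f , eq , d = X , suc f , trans eq (sym (box-cons k X f)) , OnDiag-cons-c w X f d
    ∈boxes⇒OnDiag {suc k} (c ∷ w) {b} p | inj₂ q with ∈-map⁻ (newColumn w) q
    ... | t , t∈ , eq with newColumn-OnDiag w t (NP.≤-pred (∈-upTo⁻ t∈))
    ...   | e , d = rCountV w ℕ.+ t , m ∸ t , trans eq e , d
    ∈boxes⇒OnDiag {suc k} (r ∷ w) {b} p with ∈-++⁻ (boxes w (suc m)) p
    ... | inj₁ q with ∈boxes⇒OnDiag w q
    ...   | X , f , eq , d = X , suc f , trans eq (sym (box-cons k X f)) , OnDiag-cons-r w X f d
    ∈boxes⇒OnDiag {suc k} (r ∷ w) {b} p | inj₂ q with ∈-map⁻ (newRow w) q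
    ... | t , t∈ , eq with newRow-OnDiag w t (NP.≤-pred (∈-upTo⁻ t∈))
    ...   | e , d = suc (m ℕ.+ rCountV w) , t , trans eq e , d

    old∈ : ∀ {k} x (w : Vec Letter k) X f → box k X f ∈ boxes w (suc m) → box (suc k) X (suc f) ∈ boxes (x ∷ w) (suc m)
    old∈ {k} c w X f p = subst (_∈ boxes (c ∷ w) (suc m)) (sym (box-cons k X f)) (∈-++⁺ˡ p)
    old∈ {k} r w X f p = subst (_∈ boxes (r ∷ w) (suc m)) (sym (box-cons k X f)) (∈-++⁺ˡ p)

    newColumn∈ : ∀ {k} (w : Vec Letter k) t X f → t ≤ m → X ≡ rCountV w ℕ.+ t → X ℕ.+ f ≡ m ℕ.+ rCountV w →
      box (suc k) X f ∈ boxes (c ∷ w) (suc m)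
    newColumn∈ w t X f tm e1 e2 = ∈-++⁺ʳ (boxes w (suc m))
      (subst (_∈ map (newColumn w) (upTo (suc m))) (newColumn≡box w t X f e1 e2) (∈-map⁺ (newColumn w) (∈-upTo⁺ (s≤s tm))))

    newRow∈ : ∀ {k} (w : Vec Letter k) t X → t ≤ m → X ≡ suc (m ℕ.+ rCountV w) → box (suc k) X t ∈ boxes (r ∷ w) (suc m)
    newRow∈ w t X tm e = ∈-++⁺ʳ (boxes w (suc m))
      (subst (_∈ map (newRow w) (upTo (suc m))) (newRow≡box w t X e) (∈-map⁺ (newRow w) (∈-upTo⁺ (s≤s tm))))

    OnDiag⇒∈boxes-c : ∀ {k} (w : Vec Letter k) → (∀ X f → OnDiag w X f → box k X f ∈ boxes w (suc m)) →
      ∀ X f → OnDiag (c ∷ w) X f → box (suc k) X f ∈ boxes (c ∷ w) (suc m)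
    OnDiag⇒∈boxes-c {k} w rec X zero (lo , hi) = newColumn∈ w m X 0 NP.≤-refl (trans Xe (NP.+-comm m (rCountV w))) (trans (NP.+-identityʳ X) Xe)
      where
      Xe : X ≡ m ℕ.+ rCountV w
      Xe = NP.≤-antisym (NP.≤-pred (subst (X <_) (trans (cong₂ ℕ._+_ (top-zero c w) (L-small (suc k) 0 z≤n)) (NP.+-comm _ 1)) hi))
                        (subst (_≤ X) (top-zero c w) lo)
    OnDiag⇒∈boxes-c {k} w rec X (suc f) (lo , hi) with f ℕ.<? m
    ... | no p = old∈ c w X f (rec X f
                    (subst (_≤ X) (top-cons-ge c w f (NP.≮⇒≥ p)) lo ,
                     subst (X <_) (cong₂ ℕ._+_ (top-cons-ge c w f (NP.≮⇒≥ p)) (L-cons-ge k f (NP.≮⇒≥ p))) hi))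
    ... | yes p with X ℕ.≟ top (c ∷ w) (suc f)
    ...   | yes e = newColumn∈ w (m ∸ suc f) X (suc f) (NP.m∸n≤m m (suc f))
                      (trans e (trans (top-small (c ∷ w) (suc f) p) (NP.+-comm (m ∸ suc f) (rCountV w))))
                      (trans (cong (ℕ._+ suc f) e) (top-small+ (c ∷ w) (suc f) p))
    ...   | no ne = old∈ c w X f (rec X f (lo' , hi'))
      where
      st : suc (top (c ∷ w) (suc f)) ≡ top w f
      st = trans (top-cons-lt c w f p) (NP.+-identityʳ _)
      lo' : top w f ≤ X
      lo' = subst (_≤ X) st (NP.≤∧≢⇒< lo (λ z → ne (sym z)))
      hi' : X < top w f ℕ.+ diagLen k f
      hi' = subst (X <_) (trans (cong (top (c ∷ w) (suc f) ℕ.+_) (L-cons-lt k f p)) (trans (NP.+-suc _ _) (cong (ℕ._+ diagLen k f) st))) hi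

    OnDiag⇒∈boxes-r : ∀ {k} (w : Vec Letter k) → (∀ X f → OnDiag w X f → box k X f ∈ boxes w (suc m)) →
      ∀ X f → OnDiag (r ∷ w) X f → box (suc k) X f ∈ boxes (r ∷ w) (suc m)
    OnDiag⇒∈boxes-r {k} w rec X zero (lo , hi) = newRow∈ w 0 X z≤n (trans Xe (NP.+-suc m (rCountV w)))
      where
      Xe : X ≡ m ℕ.+ suc (rCountV w)
      Xe = NP.≤-antisym (NP.≤-pred (subst (X <_) (trans (cong₂ ℕ._+_ (top-zero r w) (L-small (suc k) 0 z≤n)) (NP.+-comm _ 1)) hi))
                        (subst (_≤ X) (top-zero r w) lo)
    OnDiag⇒∈boxes-r {k} w rec X (suc f) (lo , hi) with f ℕ.<? m
    ... | no p = old∈ r w X f (rec X f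
                    (subst (_≤ X) (top-cons-r w f) lo ,
                     subst (X <_) (cong₂ ℕ._+_ (top-cons-r w f) (L-cons-ge k f (NP.≮⇒≥ p))) hi))
    ... | yes p with X ℕ.<? top w f ℕ.+ diagLen k f
    ...   | yes q = old∈ r w X f (rec X f (subst (_≤ X) (top-cons-r w f) lo , q))
    ...   | no q = newRow∈ w (suc f) X p (trans Xe (run-end-small w f (NP.<⇒≤ p)))
      where
      Xe : X ≡ top w f ℕ.+ diagLen k f
      Xe = NP.≤-antisym (NP.≤-pred (subst (X <_) (trans (cong₂ ℕ._+_ (top-cons-r w f) (L-cons-lt k f p)) (NP.+-suc _ _)) hi)) (NP.≮⇒≥ q)

    OnDiag⇒∈boxes : ∀ {k} (w : Vec Letter k) X f → OnDiag w X f → box k X f ∈ boxes w (suc m)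
    OnDiag⇒∈boxes [] X f d with OnDiag⇒square X f d
    ... | Xm , mX , Xmm = subst (_∈ boxes [] (suc m)) (sym (box-square X f ((X ℕ.+ f) ∸ m) (sym (NP.m+[n∸m]≡n mX))))
                            (∈square⇐ X ((X ℕ.+ f) ∸ m) Xm (NP.m≤n+o⇒m∸n≤o (X ℕ.+ f) m Xmm))
    OnDiag⇒∈boxes (c ∷ w) = OnDiag⇒∈boxes-c w (OnDiag⇒∈boxes w)
    OnDiag⇒∈boxes (r ∷ w) = OnDiag⇒∈boxes-r w (OnDiag⇒∈boxes w)

    box-injective : ∀ {k X X' f f'} → box k X f ≡ box k X' f' → X ≡ X' × f ≡ f'
    box-injective {k} {X} {X'} {f} {f'} e with ZP.+-injective (cong proj₁ e)
    ... | refl = refl , NP.+-cancelˡ-≡ X f f' (ZP.+-injective (sub-cancelʳ-ℤ {+ (m ℕ.+ k)} (cong proj₂ e)))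

    square-unique : Unique (boxes [] (suc m))
    square-unique = UP.concat⁺ (AllP.map⁺ (All.tabulate (λ {i} _ → UP.map⁺ (λ e → ZP.+-injective (cong proj₂ e)) (UP.upTo⁺ (suc m)))))
            (APP.map⁺ (AllPairs.map (λ {i} {j} i≢j {v} (p , q) → i≢j (rowOf i p j q)) (UP.upTo⁺ (suc m))))
      where
      rowOf : ∀ i {v} → v ∈ map (λ j → (+ i , + j)) (upTo (suc m)) → ∀ j → v ∈ map (λ j' → (+ j , + j')) (upTo (suc m)) → i ≡ j
      rowOf i p j q with ∈-map⁻ (λ j → (+ i , + j)) p | ∈-map⁻ (λ j' → (+ j , + j')) q
      ... | _ , _ , e1 | _ , _ , e2 = ZP.+-injective (trans (sym (cong proj₁ e1)) (cong proj₁ e2))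

    -- The listed boxes of (w , m+1) are pairwise distinct: the column (row)
    -- added by a letter lies outside the diagram it is attached to.
    boxes-unique : ∀ {k} (w : Vec Letter k) → Unique (boxes w (suc m))
    boxes-unique [] = square-unique
    boxes-unique {suc k} (c ∷ w) = UP.++⁺ (boxes-unique w) (UP.map⁺ (λ e → ZP.+-injective (+-cancelˡ-ℤ {bottomRow (suc m) w - + suc m + + 1} (cong proj₁ e))) (UP.upTo⁺ (suc m))) disj
      where
      disj : ∀ {v} → ¬ (v ∈ boxes w (suc m) × v ∈ map (newColumn w) (upTo (suc m)))
      disj (p , q) with ∈boxes⇒OnDiag w p | ∈-map⁻ (newColumn w) q
      ... | X , f , e1 , lo , hi | t , t∈ , e2 with box-injective {suc k} (trans (sym (trans e1 (sym (box-cons k X f)))) (trans e2 (proj₁ (newColumn-OnDiag w t (NP.≤-pred (∈-upTo⁻ t∈))))))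
      ...   | eX , ef = NP.<-irrefl refl (subst (ℕ._≤ X ℕ.+ f) (sym (trans (sym (NP.+-suc X f)) ee)) bad0)
        where
        tm : t ≤ m
        tm = NP.≤-pred (∈-upTo⁻ t∈)
        fm : f < m
        fm = subst (λ z → z ≤ m) (sym ef) (NP.m∸n≤m m t)
        ee : X ℕ.+ suc f ≡ m ℕ.+ rCountV w
        ee = trans (cong₂ ℕ._+_ eX ef) (newColumn-diag w t tm)
        bad0 : m ℕ.+ rCountV w ≤ X ℕ.+ f
        bad0 = subst (_≤ X ℕ.+ f) (top-small+ w f (NP.<⇒≤ fm)) (NP.+-monoˡ-≤ f lo)
    boxes-unique {suc k} (r ∷ w) = UP.++⁺ (boxes-unique w) (UP.map⁺ (λ e → ZP.+-injective (+-cancelˡ-ℤ {leftCol w} (cong proj₂ e))) (UP.upTo⁺ (suc m))) disj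
      where
      disj : ∀ {v} → ¬ (v ∈ boxes w (suc m) × v ∈ map (newRow w) (upTo (suc m)))
      disj (p , q) with ∈boxes⇒OnDiag w p | ∈-map⁻ (newRow w) q
      ... | X , f , e1 , lo , hi | t , t∈ , e2 with box-injective {suc k} (trans (sym (trans e1 (sym (box-cons k X f)))) (trans e2 (newRow≡box w t _ refl)))
      ...   | eX , ef = NP.<-irrefl (sym eq2) hi
        where
        fm : f < m
        fm = subst (λ z → z ≤ m) (sym ef) (NP.≤-pred (∈-upTo⁻ t∈))
        eq2 : top w f ℕ.+ diagLen k f ≡ X
        eq2 = trans (run-end-small w f (NP.<⇒≤ fm)) (sym eX)


-- For a bound τ and a diagonal f, R f τ counts, from the top of the
-- diagonal, the labels j < τ whose head diagonal σ(j) lies in the window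
-- [f - m, f] of f.  These numbers define the filling used for sufficiency; their
-- behaviour from one diagonal to the next is where the condition on σ enters.
module Windows where

  open import Data.Nat as ℕ using (ℕ; zero; suc; z≤n; s≤s; _≤_; _<_; _∸_; _⊓_; _≤?_; _+_)
  import Data.Nat.Properties as NP
  import Data.Nat.Tactic.RingSolver as NS
  open import Data.Bool using (Bool; _∧_)
  open import Data.Bool.Properties using (∧-zeroʳ; ∧-identityʳ)
  open import Data.Fin as Fin using (Fin; toℕ; inject≤; _↑ʳ_)
  import Data.Fin.Properties as FP
  open import Data.Fin.Permutation using (Permutation′; _⟨$⟩ʳ_; _⟨$⟩ˡ_; inverseˡ; inverseʳ)
  open import Data.Vec using (Vec; lookup)
  open import Data.Product using (Σ; _×_; _,_; proj₁; proj₂; ∃)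
  open import Data.Sum using (_⊎_; inj₁; inj₂)
  open import Data.Empty using (⊥-elim)
  open import Relation.Nullary using (yes; no)
  open import Relation.Binary.PropositionalEquality
  open import Function.Bundles using (_⇔_; mk⇔)
  open import Defs
  open Counting
  open Profile

  -- Reading a natural number as an element of Fin (suc j) (faithful below j + 1).
  clip : (j : ℕ) → ℕ → Fin (suc j)
  clip j zero = Fin.zero
  clip zero (suc x) = Fin.zero
  clip (suc j) (suc x) = Fin.suc (clip j x)

  toℕ-clip : ∀ j x → x ≤ j → toℕ (clip j x) ≡ x
  toℕ-clip j zero _ = refl
  toℕ-clip (suc j) (suc x) (s≤s p) = cong suc (toℕ-clip j x p)

  clip-toℕ : ∀ j (v : Fin (suc j)) → clip j (toℕ v) ≡ v
  clip-toℕ j v = FP.toℕ-injective (toℕ-clip j (toℕ v) (NP.≤-pred (FP.toℕ<n v)))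

  classify : ∀ m k f → f < m ⊎ (Σ (Fin k) λ i → f ≡ m + toℕ i) ⊎ m + k ≤ f
  classify m k f with f ℕ.<? m
  ... | yes p = inj₁ p
  ... | no p with f ∸ m ℕ.<? k
  ...   | yes q = inj₂ (inj₁ (Fin.fromℕ< q , trans (sym (NP.m+[n∸m]≡n (NP.≮⇒≥ p))) (cong (m +_) (sym (FP.toℕ-fromℕ< q)))))
  ...   | no q = inj₂ (inj₂ (subst (m + k ≤_) (NP.m+[n∸m]≡n (NP.≮⇒≥ p)) (NP.+-monoʳ-≤ m (NP.≮⇒≥ q))))

  module Window (m k : ℕ) (w : Vec Letter k) (σ : Permutation′ (suc (m + k))) where
    open Shape m

    -- Labels and diagonals are read in ℕ: inv = σ⁻¹ and sg = σ, extended arbitrarily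
    -- beyond N.
    K N : ℕ
    K = m + k
    N = suc K

    inv sg : ℕ → ℕ
    inv dd = toℕ (σ ⟨$⟩ˡ clip K dd)
    sg τ = toℕ (σ ⟨$⟩ʳ clip K τ)

    Condition : Set
    Condition = ∀ (i : Fin k) →
      (lookup w i ≡ c → inv (toℕ i) < inv (suc m + toℕ i)) ×
      (lookup w i ≡ r → inv (suc m + toℕ i) < inv (toℕ i))

    inv<N : ∀ dd → inv dd < N
    inv<N dd = FP.toℕ<n _
    sg<N : ∀ τ → sg τ < N
    sg<N τ = FP.toℕ<n _

    inv-σ : ∀ u → inv (toℕ (σ ⟨$⟩ʳ u)) ≡ toℕ u
    inv-σ u = trans (cong (λ z → toℕ (σ ⟨$⟩ˡ z)) (clip-toℕ K (σ ⟨$⟩ʳ u))) (cong toℕ (inverseˡ σ))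

    inv-sg : ∀ {τ dd} → τ < N → dd < N → inv dd ≡ τ → dd ≡ sg τ
    inv-sg {τ} {dd} τ< dd< e =
      trans (sym (toℕ-clip K dd (NP.≤-pred dd<)))
        (cong toℕ (trans (sym (inverseʳ σ)) (cong (σ ⟨$⟩ʳ_) (FP.toℕ-injective (trans e (sym (toℕ-clip K τ (NP.≤-pred τ<))))))))

    sg-inv : ∀ {τ} → τ < N → inv (sg τ) ≡ τ
    sg-inv {τ} τ< = trans (inv-σ (clip K τ)) (toℕ-clip K τ (NP.≤-pred τ<))

    inv-inj : ∀ {a b} → a < N → b < N → inv a ≡ inv b → a ≡ b
    inv-inj {a} {b} aN bN e = trans (inv-sg (inv<N a) aN refl) (sym (inv-sg (inv<N a) bN (sym e)))

    StatedCondition : Set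
    StatedCondition = ∀ (i : Fin k) →
      (lookup w i ≡ c → (σ ⟨$⟩ˡ inject≤ i (NP.m≤n+m k (suc m))) Fin.< (σ ⟨$⟩ˡ (suc m ↑ʳ i))) ×
      (lookup w i ≡ r → (σ ⟨$⟩ˡ (suc m ↑ʳ i)) Fin.< (σ ⟨$⟩ˡ inject≤ i (NP.m≤n+m k (suc m))))

    Condition⇔StatedCondition : Condition ⇔ StatedCondition
    Condition⇔StatedCondition = mk⇔
      (λ h i → (λ eL → subst₂ _<_ (sym (low i)) (sym (high i)) (proj₁ (h i) eL)) ,
               (λ eL → subst₂ _<_ (sym (high i)) (sym (low i)) (proj₂ (h i) eL)))
      (λ h i → (λ eL → subst₂ _<_ (low i) (high i) (proj₁ (h i) eL)) ,
               (λ eL → subst₂ _<_ (high i) (low i) (proj₂ (h i) eL)))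
      where
      low : ∀ (i : Fin k) → toℕ (σ ⟨$⟩ˡ inject≤ i (NP.m≤n+m k (suc m))) ≡ inv (toℕ i)
      low i = cong (λ z → toℕ (σ ⟨$⟩ˡ z)) (FP.toℕ-injective (trans (FP.toℕ-inject≤ i (NP.m≤n+m k (suc m)))
                (sym (toℕ-clip K (toℕ i) (NP.≤-trans (NP.<⇒≤ (FP.toℕ<n i)) (NP.m≤n+m k m))))))
      high : ∀ (i : Fin k) → toℕ (σ ⟨$⟩ˡ (suc m ↑ʳ i)) ≡ inv (suc m + toℕ i)
      high i = cong (λ z → toℕ (σ ⟨$⟩ˡ z)) (FP.toℕ-injective (trans (FP.toℕ-↑ʳ (suc m) i)
                (sym (toℕ-clip K (suc m + toℕ i) (NP.+-monoʳ-< m (FP.toℕ<n i))))))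

    below : ℕ → ℕ → Bool
    below τ dd = ltb (inv dd) τ ∧ ltb dd N

    P : ℕ → ℕ → ℕ
    P a τ = count a (below τ)

    below-point : ∀ {τ} → τ < N → ∀ dd → bit (below (suc τ) dd) ≡ bit (below τ dd) + bit (eqb dd (sg τ))
    below-point {τ} τ< dd with dd ℕ.<? N
    ... | no p rewrite ltb-f {dd} {N} (NP.≮⇒≥ p) | ∧-zeroʳ (leb (inv dd) τ) | ∧-zeroʳ (ltb (inv dd) τ)
           | eqb-f {dd} {sg τ} (λ e → p (subst (_< N) (sym e) (sg<N τ))) = refl
    ... | yes p rewrite ltb-t p | ∧-identityʳ (leb (inv dd) τ) | ∧-identityʳ (ltb (inv dd) τ) with inv dd ℕ.≟ τ
    ...   | yes e rewrite sym (inv-sg τ< p e) | eqb-t dd | e | ltb-f {τ} {τ} NP.≤-refl | leb-t (NP.≤-refl {τ}) = refl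
    ...   | no ne rewrite eqb-f {dd} {sg τ} (λ e → ne (trans (cong inv e) (sg-inv τ<))) with inv dd ℕ.<? τ
    ...     | yes q rewrite ltb-t q | leb-t (NP.<⇒≤ q) = refl
    ...     | no q rewrite ltb-f (NP.≮⇒≥ q) | leb-f {inv dd} {τ} (NP.≤∧≢⇒< (NP.≮⇒≥ q) (λ z → ne (sym z))) = refl

    P-suc-τ : ∀ {τ} → τ < N → ∀ a → P a (suc τ) ≡ P a τ + bit (ltb (sg τ) a)
    P-suc-τ {τ} τ< a = trans (count-add a (below-point τ<)) (cong (P a τ +_) (count-point a (sg τ)))

    P0 : ∀ a → P a 0 ≡ 0
    P0 a = count-false a

    PN : ∀ a → P a N ≡ N ⊓ a
    PN a = trans (count-cong a (λ d _ → cong (_∧ leb d K) (ltb-t (inv<N d)))) (count-window a 0 K)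

    P-mono : ∀ {a b} τ → a ≤ b → P a τ ≤ P b τ
    P-mono {a} {b} τ = count-mono a b (below τ)

    -- C f τ = #{labels j < τ with σ(j) in the window [f - m, f]}, and R f τ is the row
    -- at which the labels ≥ τ begin on diagonal f.
    C : ℕ → ℕ → ℕ
    C f τ = P (suc f) τ ∸ P (f ∸ m) τ

    R : ℕ → ℕ → ℕ
    R f τ = top w f + C f τ

    windowStart≤ : ∀ f → f ∸ m ≤ suc f
    windowStart≤ f = NP.≤-trans (NP.m∸n≤m f m) (NP.n≤1+n f)

    -- R without truncated subtraction.
    R-def : ∀ f τ → R f τ + P (f ∸ m) τ ≡ top w f + P (suc f) τ
    R-def f τ = trans (NP.+-assoc (top w f) _ _) (cong (top w f +_) (NP.m∸n+n≡m (P-mono τ (windowStart≤ f))))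

    R0 : ∀ f → R f 0 ≡ top w f
    R0 f = trans (cong (λ z → top w f + (z ∸ P (f ∸ m) 0)) (P0 (suc f))) (trans (cong (λ z → top w f + (0 ∸ z)) (P0 (f ∸ m))) (NP.+-identityʳ _))

    RN : ∀ f → R f N ≡ top w f + diagLen k f
    RN f = cong (top w f +_) (trans (cong₂ _∸_ (PN (suc f)) (PN (f ∸ m))) (trans e (sym (count-window N (f ∸ m) f))))
      where
      e : (N ⊓ suc f) ∸ (N ⊓ (f ∸ m)) ≡ (suc f ⊓ N) ∸ (f ∸ m)
      e with f ∸ m ≤? N
      ... | yes p rewrite NP.m≥n⇒m⊓n≡n p | NP.⊓-comm N (suc f) = refl
      ... | no p = trans (cong₂ _∸_ (NP.m≤n⇒m⊓n≡m (NP.≤-trans Nlo (windowStart≤ f))) (NP.m≤n⇒m⊓n≡m Nlo))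
                     (trans (NP.n∸n≡0 N) (sym (trans (cong (_∸ (f ∸ m)) (NP.m≥n⇒m⊓n≡n (NP.≤-trans Nlo (windowStart≤ f)))) (NP.m≤n⇒m∸n≡0 Nlo))))
        where
        Nlo : N ≤ f ∸ m
        Nlo = NP.<⇒≤ (NP.≰⇒> p)

    R-suc-τ : ∀ f {τ} → τ < N → R f (suc τ) ≡ R f τ + bit (window (f ∸ m) f (sg τ))
    R-suc-τ f {τ} τ< = NP.+-cancelʳ-≡ (P (f ∸ m) τ + bit (ltb (sg τ) (f ∸ m))) _ _ chain
      where
      h : ℕ
      h = sg τ
      chain : R f (suc τ) + (P (f ∸ m) τ + bit (ltb h (f ∸ m))) ≡ R f τ + bit (window (f ∸ m) f h) + (P (f ∸ m) τ + bit (ltb h (f ∸ m)))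
      chain = begin
        R f (suc τ) + (P (f ∸ m) τ + bit (ltb h (f ∸ m))) ≡⟨ cong (R f (suc τ) +_) (sym (P-suc-τ τ< (f ∸ m))) ⟩
        R f (suc τ) + P (f ∸ m) (suc τ) ≡⟨ R-def f (suc τ) ⟩
        top w f + P (suc f) (suc τ) ≡⟨ cong (top w f +_) (P-suc-τ τ< (suc f)) ⟩
        top w f + (P (suc f) τ + bit (ltb h (suc f))) ≡⟨ cong (λ z → top w f + (P (suc f) τ + z)) (window-split h (f ∸ m) f (windowStart≤ f)) ⟩
        top w f + (P (suc f) τ + (bit (ltb h (f ∸ m)) + bit (window (f ∸ m) f h))) ≡⟨ sym (NP.+-assoc (top w f) _ _) ⟩
        top w f + P (suc f) τ + (bit (ltb h (f ∸ m)) + bit (window (f ∸ m) f h)) ≡⟨ cong (_+ (bit (ltb h (f ∸ m)) + bit (window (f ∸ m) f h))) (sym (R-def f τ)) ⟩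
        R f τ + P (f ∸ m) τ + (bit (ltb h (f ∸ m)) + bit (window (f ∸ m) f h)) ≡⟨ lem (R f τ) (P (f ∸ m) τ) (bit (ltb h (f ∸ m))) (bit (window (f ∸ m) f h)) ⟩
        R f τ + bit (window (f ∸ m) f h) + (P (f ∸ m) τ + bit (ltb h (f ∸ m))) ∎
        where
        open ≡-Reasoning
        lem : ∀ a b x y → a + b + (x + y) ≡ a + y + (b + x)
        lem = NS.solve-∀

    belowBit : ℕ → ℕ → ℕ
    belowBit τ dd = bit (below τ dd)

    belowBit-in : ∀ τ {dd} → dd < N → belowBit τ dd ≡ bit (ltb (inv dd) τ)
    belowBit-in τ {dd} p = cong bit (trans (cong (ltb (inv dd) τ ∧_) (ltb-t p)) (∧-identityʳ _))

    belowBit-out : ∀ τ {dd} → N ≤ dd → belowBit τ dd ≡ 0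
    belowBit-out τ {dd} p = cong bit (trans (cong (ltb (inv dd) τ ∧_) (ltb-f p)) (∧-zeroʳ _))

    belowBit-anti : ∀ τ {a b} → a < N → b < N → inv a < inv b → belowBit τ b ≤ belowBit τ a
    belowBit-anti τ {a} {b} aN bN lt rewrite belowBit-in τ aN | belowBit-in τ bN with inv b ℕ.<? τ
    ... | yes q rewrite ltb-t q | ltb-t (NP.<-trans lt q) = NP.≤-refl
    ... | no q rewrite ltb-f {inv b} {τ} (NP.≮⇒≥ q) = z≤n

    P-snoc : ∀ a τ → P (suc a) τ ≡ P a τ + belowBit τ a
    P-snoc a τ = count-snoc a (below τ)

    OneStep : ℕ → ℕ → Set
    OneStep f τ = R (suc f) τ ≤ R f τ × R f τ ≤ suc (R (suc f) τ)

    -- Inside the square the window of f + 1 only gains the label σ⁻¹(f+1)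
    -- while the top moves up by one.
    R-step-square : ∀ f τ → f < m → OneStep f τ
    R-step-square f τ f<m = step-bounds {x = 1} {y = belowBit τ (suc f)} e1 e2 (bit≤1 _) (s≤s z≤n)
      where
      e1 : R f τ + 0 ≡ top w (suc f) + P (suc f) τ + 1
      e1 = trans (cong (R f τ +_) (cong (λ z → P z τ) (sym (NP.m≤n⇒m∸n≡0 (NP.<⇒≤ f<m)))))
             (trans (R-def f τ) (trans (cong (_+ P (suc f) τ) (top-lt w f f<m)) (NP.+-comm 1 _)))
      e2 : R (suc f) τ + 0 ≡ top w (suc f) + P (suc f) τ + belowBit τ (suc f)
      e2 = trans (cong (R (suc f) τ +_) (cong (λ z → P z τ) (sym (NP.m≤n⇒m∸n≡0 f<m))))
             (trans (R-def (suc f) τ) (trans (cong (top w (suc f) +_) (P-snoc (suc f) τ)) (sym (NP.+-assoc (top w (suc f)) (P (suc f) τ) (belowBit τ (suc f))))))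

    -- Past the last letter the top stays in row 0 and the window of f + 1 only
    -- loses the label σ⁻¹(f - m).
    R-step-beyond : ∀ f τ → m + k ≤ f → OneStep f τ
    R-step-beyond f τ mk≤f = step-bounds {x = belowBit τ (f ∸ m)} {y = 0} e1 e2 z≤n (NP.≤-trans (bit≤1 _) NP.≤-refl)
      where
      sf≡ : suc f ∸ m ≡ suc (f ∸ m)
      sf≡ = NP.+-∸-assoc 1 (NP.≤-trans (NP.m≤m+n m k) mk≤f)
      e1 : R f τ + (P (f ∸ m) τ + belowBit τ (f ∸ m)) ≡ P (suc f) τ + belowBit τ (f ∸ m)
      e1 = trans (sym (NP.+-assoc (R f τ) _ _)) (cong (_+ belowBit τ (f ∸ m)) (trans (R-def f τ) (cong (_+ P (suc f) τ) (top-hi w f mk≤f))))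
      e2 : R (suc f) τ + (P (f ∸ m) τ + belowBit τ (f ∸ m)) ≡ P (suc f) τ + 0
      e2 = trans (cong (R (suc f) τ +_) (trans (sym (P-snoc (f ∸ m) τ)) (cong (λ z → P z τ) (sym sf≡))))
            (trans (R-def (suc f) τ) (trans (cong₂ _+_ (top-hi w (suc f) (NP.≤-trans mk≤f (NP.n≤1+n f))) (P-snoc (suc f) τ))
              (cong (P (suc f) τ +_) (belowBit-out τ (s≤s mk≤f)))))

    -- Between the diagonals m + i and m + i + 1 the window trades the label
    -- σ⁻¹(i) for σ⁻¹(n + i) and the top moves down by [w_i = r]; R moves by 0
    -- or 1 exactly under the hypothesis of the theorem at position i.
    R-step-letter : ∀ (i : Fin k) τ →
      (lookup w i ≡ c → inv (toℕ i) < inv (suc m + toℕ i)) →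
      (lookup w i ≡ r → inv (suc m + toℕ i) < inv (toℕ i)) →
      OneStep (m + toℕ i) τ
    R-step-letter i τ hypC hypR = go (lookup w i) refl
      where
      I f : ℕ
      I = toℕ i
      f = m + I
      f≡ : f ∸ m ≡ I
      f≡ = NP.m+n∸m≡n m I
      sf≡ : suc f ∸ m ≡ suc I
      sf≡ = trans (cong (_∸ m) (sym (NP.+-suc m I))) (NP.m+n∸m≡n m (suc I))
      IN : I < N
      IN = NP.≤-trans (FP.toℕ<n i) (NP.≤-trans (NP.m≤n+m k m) (NP.n≤1+n _))
      nIN : suc m + I < N
      nIN = s≤s (NP.+-monoʳ-< m (FP.toℕ<n i))
      go : ∀ l → lookup w i ≡ l → OneStep f τ
      go l eL = step-bounds {x = isRow l + belowBit τ I} {y = belowBit τ (suc m + I)} e1 e2 (yx l eL) (xy l eL)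
        where
        open ≡-Reasoning
        lem : ∀ a b d e → a + b + d + e ≡ b + d + (a + e)
        lem = NS.solve-∀
        e1 : R f τ + (P I τ + belowBit τ I) ≡ top w (suc f) + P (suc f) τ + (isRow l + belowBit τ I)
        e1 = begin
          R f τ + (P I τ + belowBit τ I)                         ≡⟨ sym (NP.+-assoc (R f τ) _ _) ⟩
          R f τ + P I τ + belowBit τ I                           ≡⟨ cong (λ z → R f τ + P z τ + belowBit τ I) (sym f≡) ⟩
          R f τ + P (f ∸ m) τ + belowBit τ I                     ≡⟨ cong (_+ belowBit τ I) (R-def f τ) ⟩
          top w f + P (suc f) τ + belowBit τ I                   ≡⟨ cong (λ z → z + P (suc f) τ + belowBit τ I) (trans (top-mid w i) (cong (λ z → isRow z + top w (suc f)) eL)) ⟩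
          isRow l + top w (suc f) + P (suc f) τ + belowBit τ I   ≡⟨ lem (isRow l) (top w (suc f)) (P (suc f) τ) (belowBit τ I) ⟩
          top w (suc f) + P (suc f) τ + (isRow l + belowBit τ I) ∎
        e2 : R (suc f) τ + (P I τ + belowBit τ I) ≡ top w (suc f) + P (suc f) τ + belowBit τ (suc f)
        e2 = begin
          R (suc f) τ + (P I τ + belowBit τ I)            ≡⟨ cong (R (suc f) τ +_) (sym (P-snoc I τ)) ⟩
          R (suc f) τ + P (suc I) τ                 ≡⟨ cong (λ z → R (suc f) τ + P z τ) (sym sf≡) ⟩
          R (suc f) τ + P (suc f ∸ m) τ             ≡⟨ R-def (suc f) τ ⟩
          top w (suc f) + P (suc (suc f)) τ         ≡⟨ cong (top w (suc f) +_) (P-snoc (suc f) τ) ⟩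
          top w (suc f) + (P (suc f) τ + belowBit τ (suc f)) ≡⟨ sym (NP.+-assoc (top w (suc f)) _ _) ⟩
          top w (suc f) + P (suc f) τ + belowBit τ (suc f) ∎
        yx : ∀ l → lookup w i ≡ l → belowBit τ (suc m + I) ≤ isRow l + belowBit τ I
        yx r _ = NP.≤-trans (bit≤1 _) (s≤s z≤n)
        yx c eL = belowBit-anti τ IN nIN (hypC eL)
        xy : ∀ l → lookup w i ≡ l → isRow l + belowBit τ I ≤ suc (belowBit τ (suc m + I))
        xy r eL = s≤s (belowBit-anti τ nIN IN (hypR eL))
        xy c _ = NP.≤-trans (bit≤1 _) (s≤s z≤n)

    module UnderCondition (hyp : Condition) where

      R-step : ∀ f τ → OneStep f τ
      R-step f τ with classify m k f
      ... | inj₁ f<m = R-step-square f τ f<m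
      ... | inj₂ (inj₁ (i , refl)) = R-step-letter i τ (proj₁ (hyp i)) (proj₂ (hyp i))
      ... | inj₂ (inj₂ mk≤f) = R-step-beyond f τ mk≤f

      R-antitone : ∀ f d τ → R (f + d) τ ≤ R f τ
      R-antitone f zero τ = NP.≤-reflexive (cong (λ z → R z τ) (NP.+-identityʳ f))
      R-antitone f (suc d) τ = NP.≤-trans (NP.≤-reflexive (cong (λ z → R z τ) (NP.+-suc f d))) (NP.≤-trans (proj₁ (R-step (f + d) τ)) (R-antitone f d τ))

      R-lipschitz : ∀ f d τ → R f τ ≤ R (f + d) τ + d
      R-lipschitz f zero τ = NP.≤-reflexive (trans (cong (λ z → R z τ) (sym (NP.+-identityʳ f))) (sym (NP.+-identityʳ _)))
      R-lipschitz f (suc d) τ = NP.≤-trans (R-lipschitz f d τ)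
        (subst (R (f + d) τ + d ≤_) (trans (sym (NP.+-suc _ d)) (cong (λ z → R z τ + suc d) (sym (NP.+-suc f d))))
          (NP.+-monoˡ-≤ d (proj₂ (R-step (f + d) τ))))

    R-monotone : ∀ f {τ τ'} → τ ≤ τ' → τ' ≤ N → R f τ ≤ R f τ'
    R-monotone f {τ} {τ'} le le' with NP.m≤n⇒∃[o]m+o≡n le
    ... | o , refl = go o le'
      where
      go : ∀ o → τ + o ≤ N → R f τ ≤ R f (τ + o)
      go zero _ = NP.≤-reflexive (cong (R f) (sym (NP.+-identityʳ τ)))
      go (suc o) p = NP.≤-trans (go o (NP.≤-trans (NP.n≤1+n _) (subst (_≤ N) (NP.+-suc τ o) p)))
        (subst (R f (τ + o) ≤_) (trans (sym (R-suc-τ f (subst (_≤ N) (NP.+-suc τ o) p))) (cong (R f) (sym (NP.+-suc τ o)))) (NP.m≤m+n _ _))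

    fillValue : ℕ → ℕ → ℕ
    fillValue X f = count N (λ τ → leb (R f (suc τ)) X)

    fillValue-char : ∀ X f v → v < N → R f v ≤ X → X < R f (suc v) → fillValue X f ≡ v
    fillValue-char X f v vN lo hi = count-threshold N _ v (NP.<⇒≤ vN) h
      where
      h : ∀ t → t < N → leb (R f (suc t)) X ≡ ltb t v
      h t tN with t ℕ.<? v
      ... | yes p = trans (leb-t (NP.≤-trans (R-monotone f p (NP.<⇒≤ vN)) lo)) (sym (ltb-t p))
      ... | no p = trans (leb-f (NP.<-≤-trans hi (R-monotone f (s≤s (NP.≮⇒≥ p)) tN))) (sym (ltb-f (NP.≮⇒≥ p)))

    fillValue-exists : ∀ X f → R f 0 ≤ X → X < R f N → ∃ λ v → v < N × R f v ≤ X × X < R f (suc v)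
    fillValue-exists X f lo hi = go N NP.≤-refl hi
      where
      go : ∀ t → t ≤ N → X < R f t → ∃ λ v → v < N × R f v ≤ X × X < R f (suc v)
      go zero _ p = ⊥-elim (NP.<-irrefl refl (NP.<-≤-trans p lo))
      go (suc t) tN p with X ℕ.<? R f t
      ... | yes q = go t (NP.≤-trans (NP.n≤1+n t) tN) q
      ... | no q = t , tN , NP.≮⇒≥ q , p


module StripGeometry where

  open import Data.Nat using (_≤_; _<_)
  open import Data.Integer as ℤ using (ℤ; +_; _-_; _+_; -_)
  import Data.Integer.Properties as ZP
  open import Data.Integer.Tactic.RingSolver
  open import Data.Product using (_×_; _,_; ∃)
  open import Data.Sum using (inj₁; inj₂)
  open import Relation.Nullary using (yes; no)
  open import Relation.Binary.PropositionalEquality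
  open import Defs

  x-1≤x+1 : ∀ (x : ℤ) → x - + 1 ℤ.≤ x + + 1
  x-1≤x+1 x = ZP.+-monoʳ-≤ x ℤ.-≤+

  adjContent : ∀ {a b : Box} → Adjacent a b → content b ℤ.≤ content a + + 1
  adjContent {i , j} {i' , j'} (inj₁ (refl , inj₁ refl)) = ZP.≤-reflexive (l i j)
    where
    l : ∀ (x y : ℤ) → y + + 1 - x ≡ y - x + + 1
    l = solve-∀
  adjContent {i , j} {i' , j'} (inj₁ (refl , inj₂ refl)) = subst (ℤ._≤ (j' + + 1 - i) + + 1) (l i j') (x-1≤x+1 (j' + + 1 - i))
    where
    l : ∀ (x y : ℤ) → y + + 1 - x - + 1 ≡ y - x
    l = solve-∀
  adjContent {i , j} {i' , j'} (inj₂ (refl , inj₁ refl)) = subst (ℤ._≤ (j - i) + + 1) (l i j) (x-1≤x+1 (j - i))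
    where
    l : ∀ (x y : ℤ) → y - x - + 1 ≡ y - (x + + 1)
    l = solve-∀
  adjContent {i , j} {i' , j'} (inj₂ (refl , inj₂ refl)) = ZP.≤-reflexive (l i' j)
    where
    l : ∀ (x y : ℤ) → y - x ≡ y - (x + + 1) + + 1
    l = solve-∀

  ivt : ∀ {S : Box → Set} {a b} → PathIn S a b → S a → ∀ (cc : ℤ) → content a ℤ.≤ cc → cc ℤ.≤ content b →
    ∃ λ x → S x × content x ≡ cc
  ivt stop sa cc p q = _ , sa , ZP.≤-antisym p q
  ivt {a = a} (step adj sb rest) sa cc p q with cc ℤ.≟ content a
  ... | yes e = a , sa , sym e
  ... | no ne = ivt rest sb cc (ZP.≤-trans (adjContent adj) (subst (ℤ._≤ cc) (ZP.+-comm (+ 1) (content a)) (ZP.i<j⇒suc[i]≤j (ZP.≤∧≢⇒< p (λ z → ne (sym z)))))) q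

  adjacent-sym : ∀ {a b} → Adjacent a b → Adjacent b a
  adjacent-sym (inj₁ (e , inj₁ p)) = inj₁ (sym e , inj₂ p)
  adjacent-sym (inj₁ (e , inj₂ p)) = inj₁ (sym e , inj₁ p)
  adjacent-sym (inj₂ (e , inj₁ p)) = inj₂ (sym e , inj₂ p)
  adjacent-sym (inj₂ (e , inj₂ p)) = inj₂ (sym e , inj₁ p)


module Construction where

  open import Data.Nat as ℕ using (ℕ; zero; suc; z≤n; s≤s; _≤_; _<_; _∸_; _≤?_)
  import Data.Nat.Properties as NP
  open import Data.Integer as ℤ using (ℤ; +_; _-_; _+_; -_; ∣_∣)
  import Data.Integer.Properties as ZP
  open import Data.Integer.Tactic.RingSolver
  open import Data.Bool using (true; false; _∧_)
  open import Data.Fin as Fin using (Fin; toℕ)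
  import Data.Fin.Properties as FP
  open import Data.Fin.Permutation using (Permutation′; _⟨$⟩ʳ_)
  open import Data.Vec using (Vec)
  open import Data.List using (List; upTo; map; filter; length)
  open import Data.List.Membership.Propositional using (_∈_)
  open import Data.List.Membership.Propositional.Properties using (∈-map⁻; ∈-map⁺; ∈-upTo⁻; ∈-upTo⁺; ∈-filter⁺; ∈-filter⁻)
  open import Data.List.Relation.Unary.Unique.Propositional using (Unique)
  import Data.List.Relation.Unary.Unique.Propositional.Properties as UP
  open import Data.Product using (_×_; _,_; proj₁; proj₂; ∃)
  open import Data.Sum using (_⊎_; inj₁; inj₂)
  open import Data.Empty using (⊥; ⊥-elim)
  open import Relation.Nullary using (yes; no)
  open import Relation.Binary.PropositionalEquality
  open import Defs
  open Lists
  open Counting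
  open Profile
  open Diagram
  open Windows
  open StripGeometry
  import Data.List.Properties as LP

  threshold-≤ : ∀ {va vb N : ℕ} (Rf : ℕ → ℕ) {X : ℕ} → (∀ {t t'} → t ≤ t' → t' ≤ N → Rf t ≤ Rf t') →
    va ≤ N → Rf va ≤ X → X < Rf (suc vb) → va ≤ vb
  threshold-≤ {va} {vb} Rf mono vaN lo hi with va ≤? vb
  ... | yes p = p
  ... | no p = ⊥-elim (NP.<-irrefl refl (NP.<-≤-trans hi (NP.≤-trans (mono (NP.≰⇒> p) vaN) lo)))

  module Build (m k : ℕ) (w : Vec Letter k) (σ : Permutation′ (suc (m ℕ.+ k)))
    (hyp : Window.Condition m k w σ) where
    open Shape m
    open Geometry m
    open Window m k w σ
    open UnderCondition hyp

    Kz : ℤ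
    Kz = + K

    fill : Box → Fin N
    fill (x , y) = clip K (fillValue ∣ x ∣ ∣ y - x + Kz ∣)

    box-diagonal : ∀ X f → (+ (X ℕ.+ f) - Kz) - + X + Kz ≡ + f
    box-diagonal X f = trans (cong (λ z → z - Kz - + X + Kz) (ZP.pos-+ X f)) (l (+ X) (+ f) Kz)
      where
      l : ∀ (a b d : ℤ) → a + b - d - a + d ≡ b
      l = solve-∀

    fill-box : ∀ X f → fill (box k X f) ≡ clip K (fillValue X f)
    fill-box X f = cong (λ z → clip K (fillValue X ∣ z ∣)) (box-diagonal X f)

    fill-on-diagonal : ∀ {X f} → OnDiag w X f → ∃ λ v → v < N × R f v ≤ X × X < R f (suc v) × toℕ (fill (box k X f)) ≡ v
    fill-on-diagonal {X} {f} (lo , hi) with fillValue-exists X f (subst (_≤ X) (sym (R0 f)) lo) (subst (X <_) (sym (RN f)) hi)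
    ... | v , vN , a , b = v , vN , a , b ,
          trans (cong toℕ (fill-box X f)) (trans (cong (λ z → toℕ (clip K z)) (fillValue-char X f v vN a b)) (toℕ-clip K v (NP.≤-pred vN)))

    -- Rows increase: moving right along a row raises f, which can only lower R.
    fill-rows : ∀ a b → InDiagram w (suc m) a → InDiagram w (suc m) b → row a ≡ row b → col a ℤ.≤ col b → fill a Fin.≤ fill b
    fill-rows a b pa pb er ec with ∈boxes⇒OnDiag w pa | ∈boxes⇒OnDiag w pb
    ... | X1 , f1 , refl , d1 | X2 , f2 , refl , d2 with ZP.+-injective er
    ... | refl with fill-on-diagonal d1 | fill-on-diagonal d2
    ...   | va , vaN , lo1 , hi1 , ea | vb , vbN , lo2 , hi2 , eb =
      subst₂ ℕ._≤_ (sym ea) (sym eb) (threshold-≤ (R f1) (R-monotone f1) (NP.<⇒≤ vaN) lo1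
        (NP.<-≤-trans hi2 (subst (λ z → R z (suc vb) ≤ R f1 (suc vb)) (NP.m+[n∸m]≡n f12) (R-antitone f1 (f2 ∸ f1) (suc vb)))))
      where
      f12 : f1 ≤ f2
      f12 = NP.+-cancelˡ-≤ X1 f1 f2 (ZP.drop‿+≤+ (sub-cancel-≤ℤ {K = Kz} ec))

    -- Columns increase: moving down a column raises X by d and lowers f by d, and
    -- R drops by at most d.
    fill-columns : ∀ a b → InDiagram w (suc m) a → InDiagram w (suc m) b → col a ≡ col b → row a ℤ.≤ row b → fill a Fin.≤ fill b
    fill-columns a b pa pb ec er with ∈boxes⇒OnDiag w pa | ∈boxes⇒OnDiag w pb
    ... | X1 , f1 , refl , d1 | X2 , f2 , refl , d2 with fill-on-diagonal d1 | fill-on-diagonal d2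
    ... | va , vaN , lo1 , hi1 , ea | vb , vbN , lo2 , hi2 , eb with NP.m≤n⇒∃[o]m+o≡n (ZP.drop‿+≤+ er)
    ... | d , refl =
      subst₂ ℕ._≤_ (sym ea) (sym eb) (threshold-≤ (R f1) (R-monotone f1) (NP.<⇒≤ vaN) lo1
        (NP.+-cancelʳ-< d X1 (R f1 (suc vb))
          (NP.<-≤-trans hi2 (subst (λ z → R f2 (suc vb) ≤ R z (suc vb) ℕ.+ d) (sym f1e) (R-lipschitz f2 d (suc vb))))))
      where
      e0 : X1 ℕ.+ f1 ≡ X1 ℕ.+ d ℕ.+ f2
      e0 = ZP.+-injective (sub-cancelʳ-ℤ {Kz} ec)
      f1e : f1 ≡ f2 ℕ.+ d
      f1e = NP.+-cancelˡ-≡ X1 f1 (f2 ℕ.+ d) (trans e0 (trans (NP.+-assoc X1 d f2) (cong (X1 ℕ.+_) (NP.+-comm d f2))))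

    window-true : ∀ {f h} → h ≤ f → f ≤ h ℕ.+ m → window (f ∸ m) f h ≡ true
    window-true {f} {h} p q rewrite leb-t (NP.m≤n+o⇒m∸n≤o f m (subst (f ≤_) (NP.+-comm h m) q)) = leb-t p

    window-true⁻ : ∀ {f h} → window (f ∸ m) f h ≡ true → h ≤ f × f ≤ h ℕ.+ m
    window-true⁻ {f} {h} e with leb (f ∸ m) h in e1 | leb h f in e2
    ... | true | true = leb-t⁻ e2 , NP.≤-trans (NP.m≤n+m∸n f m) (subst (m ℕ.+ (f ∸ m) ≤_) (NP.+-comm m h) (NP.+-monoʳ-≤ m (leb-t⁻ e1)))
    window-true⁻ {f} {h} () | true | false
    window-true⁻ {f} {h} () | false | _

    module Strip (v : Fin N) where
      vv h : ℕ
      vv = toℕ v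
      h = sg vv

      vN : vv < N
      vN = FP.toℕ<n v

      stair : ℕ → Box
      stair f = box k (R f vv) f

      InStrip : Box → Set
      InStrip = StripOf w (suc m) fill v

      strip⇒stair : ∀ {b} → InStrip b → ∃ λ f → b ≡ stair f × h ≤ f × f ≤ h ℕ.+ m
      strip⇒stair (p , e) with ∈boxes⇒OnDiag w p
      ... | X , f , refl , d with fill-on-diagonal d
      ...   | v' , v'N , lo , hi , ev with trans (sym ev) (cong toℕ e)
      ...     | refl with window (f ∸ m) f h in eW
      ...       | false = ⊥-elim (NP.<⇒≱ X<R lo)
        where
        X<R : X < R f vv
        X<R = subst (X <_) (trans (R-suc-τ f vN) (trans (cong (λ z → R f vv ℕ.+ bit z) eW) (NP.+-identityʳ _))) hi
      ...       | true = f , cong (λ z → box k z f) (NP.≤-antisym (NP.≤-pred (subst (X <_) (trans (R-suc-τ f vN) (trans (cong (λ z → R f vv ℕ.+ bit z) eW) (NP.+-comm _ 1))) hi)) lo) ,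
                         window-true⁻ eW

      stair⇒strip : ∀ f → h ≤ f → f ≤ h ℕ.+ m → InStrip (stair f)
      stair⇒strip f p q = OnDiag⇒∈boxes w (R f vv) f (lo , hi) ,
         trans (fill-box (R f vv) f) (trans (cong (clip K) (fillValue-char (R f vv) f vv vN NP.≤-refl lt)) (clip-toℕ K v))
        where
        lt : R f vv < R f (suc vv)
        lt = subst (R f vv <_) (sym (trans (R-suc-τ f vN) (trans (cong (λ z → R f vv ℕ.+ bit z) (window-true p q)) (NP.+-comm _ 1)))) NP.≤-refl
        lo : top w f ≤ R f vv
        lo = subst (_≤ R f vv) (R0 f) (R-monotone f z≤n (NP.<⇒≤ vN))
        hi : R f vv < top w f ℕ.+ diagLen k f
        hi = subst (R f vv <_) (RN f) (NP.<-≤-trans lt (R-monotone f vN NP.≤-refl))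

      stairList : List Box
      stairList = map (λ j → stair (h ℕ.+ j)) (upTo (suc m))

      strip-size : length (filter (λ b → fill b FP.≟ v) (boxes w (suc m))) ≡ suc m
      strip-size = trans (unique-length-≡ (UP.filter⁺ (λ b → fill b FP.≟ v) (boxes-unique w)) uSL sub1 sub2)
                (trans (LP.length-map _ (upTo (suc m))) (LP.length-upTo (suc m)))
        where
        uSL : Unique stairList
        uSL = UP.map⁺ (λ {x} {y} e → NP.+-cancelˡ-≡ h x y (proj₂ (box-injective {k} e))) (UP.upTo⁺ (suc m))
        sub1 : ∀ {x} → x ∈ filter (λ b → fill b FP.≟ v) (boxes w (suc m)) → x ∈ stairList
        sub1 {x} p with ∈-filter⁻ (λ b → fill b FP.≟ v) p
        ... | xb , e with strip⇒stair (xb , e)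
        ...   | f , refl , hf , fh = subst (_∈ stairList) (cong stair (NP.m+[n∸m]≡n hf))
                  (∈-map⁺ (λ j → stair (h ℕ.+ j)) (∈-upTo⁺ (s≤s (NP.m≤n+o⇒m∸n≤o f h fh))))
        sub2 : ∀ {x} → x ∈ stairList → x ∈ filter (λ b → fill b FP.≟ v) (boxes w (suc m))
        sub2 {x} p with ∈-map⁻ (λ j → stair (h ℕ.+ j)) p
        ... | j , j∈ , refl with stair⇒strip (h ℕ.+ j) (NP.m≤m+n h j) (NP.+-monoʳ-≤ h (NP.≤-pred (∈-upTo⁻ j∈)))
        ...   | xb , e = ∈-filter⁺ (λ b → fill b FP.≟ v) xb e

      -- Consecutive staircase boxes are adjacent (R f v drops by 0 or 1), ...
      stair-adjacent : ∀ f → Adjacent (stair f) (stair (suc f))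
      stair-adjacent f with R f vv ℕ.≟ R (suc f) vv
      ... | yes e = inj₁ (cong +_ e , inj₁ (trans (cong (λ z → + (z ℕ.+ suc f) - Kz) (sym e)) (l1 (R f vv) f)))
        where
        l1 : ∀ a b → + (a ℕ.+ suc b) - Kz ≡ + (a ℕ.+ b) - Kz + + 1
        l1 a b = trans (cong (λ z → + z - Kz) (NP.+-suc a b)) (trans (cong (_- Kz) (ZP.pos-+ 1 (a ℕ.+ b))) (l (+ (a ℕ.+ b)) Kz))
          where
          l : ∀ (x y : ℤ) → + 1 + x - y ≡ x - y + + 1
          l = solve-∀
      ... | no ne = inj₂ (cong (λ z → + z - Kz) e2 , inj₂ (trans (cong +_ e1) (trans (ZP.pos-+ 1 (R (suc f) vv)) (ZP.+-comm (+ 1) (+ R (suc f) vv)))))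
        where
        e1 : R f vv ≡ suc (R (suc f) vv)
        e1 = NP.≤-antisym (proj₂ (R-step f vv)) (NP.≤∧≢⇒< (proj₁ (R-step f vv)) (λ z → ne (sym z)))
        e2 : R f vv ℕ.+ f ≡ R (suc f) vv ℕ.+ suc f
        e2 = trans (cong (ℕ._+ f) e1) (sym (NP.+-suc _ f))

      stair-path-up : ∀ f d → h ≤ f → f ℕ.+ d ≤ h ℕ.+ m → PathIn InStrip (stair f) (stair (f ℕ.+ d))
      stair-path-up f zero p q = subst (PathIn InStrip (stair f)) (cong stair (sym (NP.+-identityʳ f))) stop
      stair-path-up f (suc d) p q = step (stair-adjacent f) (stair⇒strip (suc f) (NP.≤-trans p (NP.n≤1+n f)) q1)
         (subst (PathIn InStrip (stair (suc f))) (cong stair (sym (NP.+-suc f d))) (stair-path-up (suc f) d (NP.≤-trans p (NP.n≤1+n f)) q2))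
        where
        q2 : suc f ℕ.+ d ≤ h ℕ.+ m
        q2 = subst (_≤ h ℕ.+ m) (NP.+-suc f d) q
        q1 : suc f ≤ h ℕ.+ m
        q1 = NP.≤-trans (NP.m≤m+n (suc f) d) q2

      stair-path-down : ∀ f d → h ≤ f → f ℕ.+ d ≤ h ℕ.+ m → PathIn InStrip (stair (f ℕ.+ d)) (stair f)
      stair-path-down f zero p q = subst (λ z → PathIn InStrip z (stair f)) (cong stair (sym (NP.+-identityʳ f))) stop
      stair-path-down f (suc d) p q = subst (λ z → PathIn InStrip z (stair f)) (cong stair (sym (NP.+-suc f d)))
         (step (adjacent-sym (stair-adjacent (f ℕ.+ d))) (stair⇒strip (f ℕ.+ d) (NP.≤-trans p (NP.m≤m+n f d)) q1) (stair-path-down f d p q1))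
        where
        q1 : f ℕ.+ d ≤ h ℕ.+ m
        q1 = NP.≤-trans (NP.n≤1+n _) (subst (_≤ h ℕ.+ m) (NP.+-suc f d) q)

      strip-connected : Connected InStrip
      strip-connected a b pa pb with strip⇒stair pa | strip⇒stair pb
      ... | f1 , refl , h1 , m1 | f2 , refl , h2 , m2 with NP.≤-total f1 f2
      ...   | inj₁ le = subst (PathIn InStrip (stair f1)) (cong stair (NP.m+[n∸m]≡n le)) (stair-path-up f1 (f2 ∸ f1) h1 (subst (_≤ h ℕ.+ m) (sym (NP.m+[n∸m]≡n le)) m2))
      ...   | inj₂ le = subst (λ z → PathIn InStrip z (stair f2)) (cong stair (NP.m+[n∸m]≡n le)) (stair-path-down f2 (f1 ∸ f2) h2 (subst (_≤ h ℕ.+ m) (sym (NP.m+[n∸m]≡n le)) m1))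

      content-stair : ∀ f → content (stair f) ≡ + f - Kz
      content-stair f = content-box (R f vv) f

      -- A staircase meets each diagonal once, hence contains no 2×2 square.
      strip-no2x2 : No2x2 InStrip
      strip-no2x2 i j s1 _ _ s4 with strip⇒stair s1 | strip⇒stair s4
      ... | f , e1 , _ | f' , e4 , _ = bad (trans (cong proj₁ e1) (trans (cong (λ z → proj₁ (stair z)) ff) (sym (cong proj₁ e4))))
        where
        cij : j - i ≡ + f - Kz
        cij = trans (cong content e1) (content-stair f)
        cij' : (j + + 1) - (i + + 1) ≡ + f' - Kz
        cij' = trans (cong content e4) (content-stair f')
        l : ∀ (a b : ℤ) → (b + + 1) - (a + + 1) ≡ b - a
        l = solve-∀
        ff : f ≡ f'
        ff = ZP.+-injective (sub-cancelʳ-ℤ {Kz} (trans (sym cij) (trans (sym (l i j)) cij')))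
        bad : i ≡ i + + 1 → ⊥
        bad e = ZP.i≢suc[i] (trans e (ZP.+-comm i (+ 1)))

      R-flat-between : ∀ f d e → e ≤ d → R (f ℕ.+ d) vv ≡ R f vv → R (f ℕ.+ e) vv ≡ R f vv
      R-flat-between f d e ed eq = NP.≤-antisym (R-antitone f e vv)
        (subst (_≤ R (f ℕ.+ e) vv) (trans (cong (λ z → R z vv) (trans (NP.+-assoc f e (d ∸ e)) (cong (f ℕ.+_) (NP.m+[n∸m]≡n ed)))) eq)
          (R-antitone (f ℕ.+ e) (d ∸ e) vv))

      R-steep-between : ∀ f d e → e ≤ d → R f vv ≡ R (f ℕ.+ d) vv ℕ.+ d → R (f ℕ.+ e) vv ℕ.+ e ≡ R f vv
      R-steep-between f d e ed eq = NP.≤-antisym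
        (subst (R (f ℕ.+ e) vv ℕ.+ e ≤_) (trans (trans (NP.+-assoc _ (d ∸ e) e) (cong₂ ℕ._+_ (cong (λ z → R z vv) (trans (NP.+-assoc f e (d ∸ e)) (cong (f ℕ.+_) (NP.m+[n∸m]≡n ed)))) (NP.m∸n+n≡m ed))) (sym eq))
          (NP.+-monoˡ-≤ e (R-lipschitz (f ℕ.+ e) (d ∸ e) vv)))
        (R-lipschitz f e vv)

      strip-skew : SkewShape InStrip
      strip-skew a b (x1 , x2) pa pb r1 r2 c1 c2 with strip⇒stair pa | strip⇒stair pb
      ... | f1 , refl , h1 , m1 | f2 , refl , h2 , m2
        with ℤ-between-ℕ r1 r2
           | ℤ-between-ℕ (subst (ℤ._≤ x2 + Kz) (sub-add _ Kz) (ZP.+-monoˡ-≤ Kz c1)) (subst (x2 + Kz ℤ.≤_) (sub-add _ Kz) (ZP.+-monoˡ-≤ Kz c2))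
      ... | Y , ex1 , Y1 , Y2 | Z , ex2 , Z1 , Z2 = cases (NP.≤-total f1 f2)
        where
        fin : ∀ g → h ≤ g → g ≤ h ℕ.+ m → R g vv ≡ Y → R g vv ℕ.+ g ≡ Z → InStrip (x1 , x2)
        fin g hg gm eY eZ = subst InStrip (sym (cong₂ _,_ (trans ex1 (cong +_ (sym eY)))
                             (trans (sym (add-sub x2 Kz)) (trans (cong (_- Kz) ex2) (cong (λ z → + z - Kz) (sym eZ))))))
                           (stair⇒strip g hg gm)
        cases : f1 ≤ f2 ⊎ f2 ≤ f1 → InStrip (x1 , x2)
        cases (inj₁ le) with NP.m≤n⇒∃[o]m+o≡n le
        ... | d , refl with NP.m≤n⇒∃[o]m+o≡n Z1
        ...   | e , refl = fin (f1 ℕ.+ e) (NP.≤-trans h1 (NP.m≤m+n f1 e)) (NP.≤-trans (NP.+-monoʳ-≤ f1 ed) m2) (trans (R-flat-between f1 d e ed Rd) (sym YR1))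
                            (trans (cong (ℕ._+ (f1 ℕ.+ e)) (R-flat-between f1 d e ed Rd)) (sym (NP.+-assoc (R f1 vv) f1 e)))
          where
          Rd : R (f1 ℕ.+ d) vv ≡ R f1 vv
          Rd = NP.≤-antisym (R-antitone f1 d vv) (NP.≤-trans Y1 Y2)
          YR1 : Y ≡ R f1 vv
          YR1 = NP.≤-antisym (NP.≤-trans Y2 (R-antitone f1 d vv)) Y1
          ed : e ≤ d
          ed = NP.+-cancelˡ-≤ (R f1 vv ℕ.+ f1) e d
                 (subst (R f1 vv ℕ.+ f1 ℕ.+ e ≤_) (trans (cong (ℕ._+ (f1 ℕ.+ d)) Rd) (sym (NP.+-assoc _ f1 d))) Z2)
        cases (inj₂ le) with NP.m≤n⇒∃[o]m+o≡n le
        ... | d , refl with NP.m≤n⇒∃[o]m+o≡n Y2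
        ...   | e , Ye = fin (f2 ℕ.+ e) (NP.≤-trans h2 (NP.m≤m+n f2 e)) (NP.≤-trans (NP.+-monoʳ-≤ f2 ed) m1)
                            (NP.+-cancelʳ-≡ e _ _ (trans (R-steep-between f2 d e ed R2e) (sym Ye)))
                            (trans (sym (NP.+-assoc _ f2 e)) (trans (cong (ℕ._+ e) (NP.+-comm (R (f2 ℕ.+ e) vv) f2))
                              (trans (NP.+-assoc f2 _ e) (trans (cong (f2 ℕ.+_) (R-steep-between f2 d e ed R2e)) (trans (NP.+-comm f2 _) (sym Zeq))))))
          where
          lip : R f2 vv ≤ R (f2 ℕ.+ d) vv ℕ.+ d
          lip = R-lipschitz f2 d vv
          chain : R (f2 ℕ.+ d) vv ℕ.+ (f2 ℕ.+ d) ≤ R f2 vv ℕ.+ f2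
          chain = NP.≤-trans Z1 Z2
          R2e : R f2 vv ≡ R (f2 ℕ.+ d) vv ℕ.+ d
          R2e = NP.≤-antisym lip (NP.+-cancelʳ-≤ f2 _ _ (subst (_≤ R f2 vv ℕ.+ f2) (trans (cong (R (f2 ℕ.+ d) vv ℕ.+_) (NP.+-comm f2 d)) (sym (NP.+-assoc _ d f2))) chain))
          Zeq : Z ≡ R f2 vv ℕ.+ f2
          Zeq = NP.≤-antisym Z2 (subst (_≤ Z) (sym (trans (cong (ℕ._+ f2) R2e) (trans (NP.+-assoc _ d f2) (cong (R (f2 ℕ.+ d) vv ℕ.+_) (NP.+-comm d f2))))) Z1)
          ed : e ≤ d
          ed = NP.+-cancelˡ-≤ Y e d (NP.≤-trans (NP.≤-reflexive Ye) (subst (R f2 vv ≤_) refl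
                (NP.≤-trans (NP.≤-reflexive R2e) (NP.+-monoˡ-≤ d Y1))))

    -- The head of strip j is its box on diagonal σ(j) + m, which carries the number σ(j) + 1.
    fill-heads : PsiIs w (suc m) fill σ
    fill-heads j = stair (h ℕ.+ m) , (stair⇒strip (h ℕ.+ m) (NP.m≤m+n h m) NP.≤-refl , maxc) , diag
      where
      open Strip j
      maxc : ∀ b → InStrip b → content b ℤ.≤ content (stair (h ℕ.+ m))
      maxc b sb with strip⇒stair sb
      ... | f , refl , hf , fm = subst₂ ℤ._≤_ (sym (content-stair f)) (sym (content-stair (h ℕ.+ m))) (ZP.+-monoˡ-≤ (- Kz) (ℤ.+≤+ fm))
      diag : diagonalNumber k (suc m) (stair (h ℕ.+ m)) ≡ + suc (toℕ (σ ⟨$⟩ʳ j))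
      diag = begin
        diagonalNumber k (suc m) (stair (h ℕ.+ m)) ≡⟨ diagonalNumber-content k (stair (h ℕ.+ m)) ⟩
        content (stair (h ℕ.+ m)) + + suc k        ≡⟨ cong (_+ + suc k) (content-stair (h ℕ.+ m)) ⟩
        + (h ℕ.+ m) - Kz + + suc k                 ≡⟨ head-diagonal k h ⟩
        + suc h                                    ≡⟨ cong (λ z → + suc (toℕ (σ ⟨$⟩ʳ z))) (clip-toℕ K j) ⟩
        + suc (toℕ (σ ⟨$⟩ʳ j))                     ∎
        where open ≡-Reasoning

    fill-is-BST : BSP w (suc m) σ
    fill-is-BST = fill , ((λ v → Strip.strip-size v) , fill-rows , fill-columns , (λ v → Strip.strip-connected v , Strip.strip-skew v , Strip.strip-no2x2 v)) , fill-heads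


module Necessity where

  open import Data.Nat as ℕ using (ℕ; suc; z≤n; s≤s; _≤_; _<_; _∸_; _⊓_; _≤?_)
  import Data.Nat.Properties as NP
  open import Data.Nat.ListAction using (sum)
  open import Data.Integer as ℤ using (ℤ; +_; _-_; _+_; -_)
  import Data.Integer.Properties as ZP
  open import Data.Integer.Tactic.RingSolver
  open import Data.Bool using (_∧_)
  open import Data.Fin as Fin using (Fin; toℕ)
  import Data.Fin.Properties as FP
  open import Data.Fin.Permutation using (Permutation′; _⟨$⟩ʳ_)
  open import Data.Vec using (Vec; lookup)
  open import Data.List using (filter; length; applyUpTo; tabulate)
  import Data.List.Properties as LP
  open import Data.List.Membership.Propositional using (_∈_)
  open import Data.List.Membership.Propositional.Properties using (∈-filter⁺; ∈-applyUpTo⁺; ∈-applyUpTo⁻; ∈-tabulate⁻)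
  open import Data.List.Relation.Unary.Unique.Propositional using (Unique)
  import Data.List.Relation.Unary.Unique.Propositional.Properties as UP
  open import Data.Product using (_×_; _,_; proj₁; proj₂; ∃)
  open import Data.Empty using (⊥; ⊥-elim)
  open import Relation.Nullary using (yes; no)
  open import Relation.Binary.PropositionalEquality
  open import Relation.Binary.Definitions using (tri<; tri≈; tri>)
  open import Defs
  open Lists
  open Counting
  open Profile
  open Diagram
  open Windows
  open StripGeometry

  module Analyse (m k : ℕ) (w : Vec Letter k) (σ : Permutation′ (suc (m ℕ.+ k)))
           (T : Filling (suc m ℕ.+ k)) (bst : IsBST w (suc m) T) (ps : PsiIs w (suc m) T σ) where
    open Shape m
    open Geometry m
    open Window m k w σ using (K; N; inv; inv-σ; inv-inj; Condition)

    Kz : ℤ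
    Kz = + K

    strip-sizes : ∀ v → length (filter (λ b → T b FP.≟ v) (boxes w (suc m))) ≡ suc m
    strip-sizes = proj₁ bst
    rows-weak : ∀ a b → InDiagram w (suc m) a → InDiagram w (suc m) b → row a ≡ row b → col a ℤ.≤ col b → T a Fin.≤ T b
    rows-weak = proj₁ (proj₂ bst)
    columns-weak : ∀ a b → InDiagram w (suc m) a → InDiagram w (suc m) b → col a ≡ col b → row a ℤ.≤ row b → T a Fin.≤ T b
    columns-weak = proj₁ (proj₂ (proj₂ bst))
    strips : ∀ v → BorderStrip (StripOf w (suc m) T v)
    strips = proj₂ (proj₂ (proj₂ bst))

    InStrip : Fin N → Box → Set
    InStrip u = StripOf w (suc m) T u

    head : Fin N → ℕ
    head u = toℕ (σ ⟨$⟩ʳ u)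

    head-box : ∀ u → ∃ λ hb → InStrip u hb × (∀ b → InStrip u b → content b ℤ.≤ content hb) × content hb ≡ + (head u ℕ.+ m) - Kz
    head-box u with ps u
    ... | hb , (sh , mx) , dg = hb , sh , mx , e
      where
      e : content hb ≡ + (head u ℕ.+ m) - Kz
      e = +-cancelʳ-ℤ (trans (sym (diagonalNumber-content k hb)) (trans dg (sym (head-diagonal k (head u)))))

    below-head : ∀ u X f → InStrip u (box k X f) → f ≤ head u ℕ.+ m
    below-head u X f sb with head-box u
    ... | hb , sh , mx , e = ZP.drop‿+≤+ (sub-cancel-≤ℤ {K = Kz} (subst₂ ℤ._≤_ (content-box X f) e (mx _ sb)))

    shifted-≤ : ∀ {a b} → a ≤ b → + a - Kz ℤ.≤ + b - Kz
    shifted-≤ p = ZP.+-monoˡ-≤ (- Kz) (ℤ.+≤+ p)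

    -- ... and at least head u: otherwise, by connectedness and the intermediate
    -- value property, it would meet the n + 1 diagonals f, …, f + n, one box each.
    reaches-window : ∀ u X f → InStrip u (box k X f) → head u ≤ f
    reaches-window u X f sb with head u ≤? f
    ... | yes p = p
    ... | no p = ⊥-elim (NP.1+n≰n (subst₂ _≤_ (LP.length-tabulate pick) (strip-sizes u) (unique-length-≤ distinct included)))
      where
      far : ∀ j → j ≤ suc m → f ℕ.+ j ≤ head u ℕ.+ m
      far j j≤ = NP.≤-trans (NP.+-monoʳ-≤ f j≤) (subst (_≤ head u ℕ.+ m) (sym (NP.+-suc f m)) (NP.+-monoˡ-≤ m (NP.≰⇒> p)))
      path : PathIn (InStrip u) (box k X f) (proj₁ (head-box u))
      path = proj₁ (strips u) _ _ sb (proj₁ (proj₂ (head-box u)))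
      hit : (j : Fin (suc (suc m))) → ∃ λ b → InStrip u b × content b ≡ + (f ℕ.+ toℕ j) - Kz
      hit j = ivt path sb (+ (f ℕ.+ toℕ j) - Kz)
        (subst (ℤ._≤ + (f ℕ.+ toℕ j) - Kz) (sym (content-box X f)) (shifted-≤ (NP.m≤m+n f (toℕ j))))
        (subst (+ (f ℕ.+ toℕ j) - Kz ℤ.≤_) (sym (proj₂ (proj₂ (proj₂ (head-box u))))) (shifted-≤ (far (toℕ j) (NP.≤-pred (FP.toℕ<n j)))))
      pick : Fin (suc (suc m)) → Box
      pick j = proj₁ (hit j)
      distinct : Unique (tabulate pick)
      distinct = UP.tabulate⁺ {f = pick} (λ {i} {j} e → FP.toℕ-injective (NP.+-cancelˡ-≡ f _ _ (ZP.+-injective (sub-cancelʳ-ℤ {Kz}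
        (trans (sym (proj₂ (proj₂ (hit i)))) (trans (cong content e) (proj₂ (proj₂ (hit j)))))))))
      included : ∀ {x} → x ∈ tabulate pick → x ∈ filter (λ b → T b FP.≟ u) (boxes w (suc m))
      included q with ∈-tabulate⁻ {f = pick} q
      ... | j , refl = ∈-filter⁺ (λ b → T b FP.≟ u) (proj₁ (proj₁ (proj₂ (hit j)))) (proj₂ (proj₁ (proj₂ (hit j))))

    -- A strip contains no two boxes on one diagonal: with the skew property they
    -- would force a 2×2 square.
    no-stacked-pair : ∀ u X X' f → X < X' → InStrip u (box k X f) → InStrip u (box k X' f) → ⊥
    no-stacked-pair u X X' f lt sa sb with NP.m≤n⇒∃[o]m+o≡n lt
    ... | d , refl = proj₂ (proj₂ (strips u)) (+ X) c0 sa
          (sk (+ X , c0 + + 1) ZP.≤-refl (ℤ.+≤+ (NP.≤-trans (NP.n≤1+n X) (NP.m≤m+n (suc X) d))) c0≤c01 c01≤c1)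
          (sk (+ X + + 1 , c0) rX≤rX1 rX1≤rX' ZP.≤-refl c0≤c1)
          (sk (+ X + + 1 , c0 + + 1) rX≤rX1 rX1≤rX' c0≤c01 c01≤c1)
      where
      c0 c1 : ℤ
      c0 = + (X ℕ.+ f) - Kz
      c1 = + (suc X ℕ.+ d ℕ.+ f) - Kz
      sk : ∀ x → + X ℤ.≤ proj₁ x → proj₁ x ℤ.≤ + (suc X ℕ.+ d) → c0 ℤ.≤ proj₂ x → proj₂ x ℤ.≤ c1 → InStrip u x
      sk x = proj₁ (proj₂ (strips u)) (box k X f) (box k (suc X ℕ.+ d) f) x sa sb
      l : ∀ (x d f K : ℤ) → + 1 + x + d + f - K ≡ x + f - K + (+ 1 + d)
      l = solve-∀
      c1e : c1 ≡ c0 + + suc d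
      c1e = trans (cong (_- Kz) (trans (ZP.pos-+ (suc X ℕ.+ d) f) (cong (_+ + f) (trans (ZP.pos-+ (suc X) d) (cong (_+ + d) (ZP.pos-+ 1 X))))))
              (trans (l (+ X) (+ d) (+ f) Kz) (cong (λ z → c0 + z) (sym (ZP.pos-+ 1 d))))
      c0≤c01 : c0 ℤ.≤ c0 + + 1
      c0≤c01 = subst (ℤ._≤ c0 + + 1) (ZP.+-identityʳ c0) (ZP.+-monoʳ-≤ c0 (ℤ.+≤+ z≤n))
      c01≤c1 : c0 + + 1 ℤ.≤ c1
      c01≤c1 = subst (c0 + + 1 ℤ.≤_) (sym c1e) (ZP.+-monoʳ-≤ c0 (ℤ.+≤+ (s≤s z≤n)))
      c0≤c1 : c0 ℤ.≤ c1
      c0≤c1 = ZP.≤-trans c0≤c01 c01≤c1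
      rX≤rX1 : + X ℤ.≤ + X + + 1
      rX≤rX1 = subst (ℤ._≤ + X + + 1) (ZP.+-identityʳ (+ X)) (ZP.+-monoʳ-≤ (+ X) (ℤ.+≤+ z≤n))
      rX1≤rX' : + X + + 1 ℤ.≤ + (suc X ℕ.+ d)
      rX1≤rX' = subst (ℤ._≤ + (suc X ℕ.+ d)) (trans (ZP.pos-+ 1 X) (ZP.+-comm (+ 1) (+ X))) (ℤ.+≤+ (NP.m≤m+n (suc X) d))

    one-box-per-diagonal : ∀ u X X' f → InStrip u (box k X f) → InStrip u (box k X' f) → X ≡ X'
    one-box-per-diagonal u X X' f sa sb with NP.<-cmp X X'
    ... | tri< lt _ _ = ⊥-elim (no-stacked-pair u X X' f lt sa sb)
    ... | tri≈ _ e _ = e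
    ... | tri> _ _ gt = ⊥-elim (no-stacked-pair u X' X f gt sb sa)

    diagLen-full : ∀ f → m ≤ f → f ≤ m ℕ.+ k → diagLen k f ≡ suc m
    diagLen-full f p q = trans (count-window (suc (m ℕ.+ k)) (f ∸ m) f)
      (trans (cong (_∸ (f ∸ m)) (NP.m≤n⇒m⊓n≡m (s≤s q)))
      (trans (NP.+-∸-assoc 1 (NP.m∸n≤m f m)) (cong suc (NP.m∸[m∸n]≡n p))))

    full-diagonal-box : ∀ f j → m ≤ f → f ≤ m ℕ.+ k → j ≤ m → InDiagram w (suc m) (box k (top w f ℕ.+ j) f)
    full-diagonal-box f j p q jm = OnDiag⇒∈boxes w _ f (NP.m≤m+n _ j , subst (top w f ℕ.+ j <_) (cong (top w f ℕ.+_) (sym (diagLen-full f p q))) (NP.+-monoʳ-< (top w f) (s≤s jm)))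

    diagLabel : ℕ → ℕ → ℕ
    diagLabel f j = toℕ (T (box k (top w f ℕ.+ j) f))

    windowLabel : ℕ → ℕ → ℕ
    windowLabel f j = inv ((f ∸ m) ℕ.+ j)

    -- Both lists carry the same labels, each once, so they have the same sum.
    diagonal-sum : ∀ f → m ≤ f → f ≤ m ℕ.+ k → sum (applyUpTo (diagLabel f) (suc m)) ≡ sum (applyUpTo (windowLabel f) (suc m))
    diagonal-sum f p q = unique-sum-≡ uA uW sub (NP.≤-reflexive (trans (LP.length-applyUpTo (windowLabel f) (suc m)) (sym (LP.length-applyUpTo (diagLabel f) (suc m)))))
      where
      fN : f < N
      fN = s≤s q
      uA : Unique (applyUpTo (diagLabel f) (suc m))
      uA = UP.applyUpTo⁺₁ (diagLabel f) (suc m) (λ {i} {j} i<j j< e →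
        NP.<-irrefl (NP.+-cancelˡ-≡ (top w f) i j (one-box-per-diagonal (T (box k (top w f ℕ.+ j) f)) _ _ f
           (full-diagonal-box f i p q (NP.≤-pred (NP.<-trans i<j j<)) , FP.toℕ-injective e) (full-diagonal-box f j p q (NP.≤-pred j<) , refl))) i<j)
      wN : ∀ j → j ≤ m → (f ∸ m) ℕ.+ j < N
      wN j jm = NP.≤-<-trans (NP.+-monoʳ-≤ (f ∸ m) jm) (subst (_< N) (sym (NP.m∸n+n≡m p)) fN)
      uW : Unique (applyUpTo (windowLabel f) (suc m))
      uW = UP.applyUpTo⁺₁ (windowLabel f) (suc m) (λ {i} {j} i<j j< e →
        NP.<-irrefl (NP.+-cancelˡ-≡ (f ∸ m) i j (inv-inj (wN i (NP.≤-pred (NP.<-trans i<j j<))) (wN j (NP.≤-pred j<)) e)) i<j)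
      sub : ∀ {x} → x ∈ applyUpTo (diagLabel f) (suc m) → x ∈ applyUpTo (windowLabel f) (suc m)
      sub pp with ∈-applyUpTo⁻ (diagLabel f) pp
      ... | j , j< , refl = subst (_∈ applyUpTo (windowLabel f) (suc m)) e (∈-applyUpTo⁺ (windowLabel f) {i = head u ∸ (f ∸ m)} (s≤s jm'))
        where
        u : Fin N
        u = T (box k (top w f ℕ.+ j) f)
        su : InStrip u (box k (top w f ℕ.+ j) f)
        su = full-diagonal-box f j p q (NP.≤-pred j<) , refl
        start≤ : f ∸ m ≤ head u
        start≤ = NP.m≤n+o⇒m∸n≤o f m (subst (f ≤_) (NP.+-comm (head u) m) (below-head u _ f su))
        jm' : head u ∸ (f ∸ m) ≤ m
        jm' = NP.m≤n+o⇒m∸n≤o (head u) (f ∸ m) (NP.≤-trans (reaches-window u _ f su) (NP.≤-trans (NP.m≤n+m∸n f m) (NP.≤-reflexive (NP.+-comm m (f ∸ m)))))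
        e : windowLabel f (head u ∸ (f ∸ m)) ≡ toℕ u
        e = trans (cong inv (NP.m+[n∸m]≡n start≤)) (inv-σ u)

    module AtLetter (i : Fin k) where
      Ii f0 : ℕ
      Ii = toℕ i
      f0 = m ℕ.+ Ii
      Ik : Ii < k
      Ik = FP.toℕ<n i
      p0 : m ≤ f0
      p0 = NP.m≤m+n m Ii
      q0 : f0 ≤ m ℕ.+ k
      q0 = NP.+-monoʳ-≤ m (NP.<⇒≤ Ik)
      p1 : m ≤ suc f0
      p1 = NP.≤-trans p0 (NP.n≤1+n f0)
      q1 : suc f0 ≤ m ℕ.+ k
      q1 = subst (_≤ m ℕ.+ k) (NP.+-suc m Ii) (NP.+-monoʳ-≤ m Ik)
      Mid : ℕ
      Mid = sum (applyUpTo (λ j → inv (suc Ii ℕ.+ j)) m)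
      window-sum-low : sum (applyUpTo (windowLabel f0) (suc m)) ≡ inv Ii ℕ.+ Mid
      window-sum-low = trans (sumUp-cong (windowLabel f0) (λ j → inv (Ii ℕ.+ j)) (suc m) (λ j _ → cong (λ z → inv (z ℕ.+ j)) (NP.m+n∸m≡n m Ii)))
             (cong₂ ℕ._+_ (cong inv (NP.+-identityʳ Ii)) (sumUp-cong _ _ m (λ j _ → cong inv (NP.+-suc Ii j))))
      window-sum-high : sum (applyUpTo (windowLabel (suc f0)) (suc m)) ≡ Mid ℕ.+ inv (suc m ℕ.+ Ii)
      window-sum-high = trans (sumUp-cong (windowLabel (suc f0)) (λ j → inv (suc Ii ℕ.+ j)) (suc m)
                   (λ j _ → cong (λ z → inv (z ℕ.+ j)) (trans (cong (_∸ m) (sym (NP.+-suc m Ii))) (NP.m+n∸m≡n m (suc Ii)))))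
             (trans (sumUp-snoc (λ j → inv (suc Ii ℕ.+ j)) m) (cong (λ z → Mid ℕ.+ inv (suc z)) (NP.+-comm Ii m)))
      neq : inv Ii ≢ inv (suc m ℕ.+ Ii)
      neq e = NP.<-irrefl ((inv-inj (NP.<-trans Ik (s≤s (NP.m≤n+m k m))) (s≤s (NP.+-monoʳ-< m Ik)) e))
               (s≤s (NP.m≤n+m Ii m))

      -- Letter c: the diagonals m + i and m + i + 1 start in the same row; along rows
      -- the labels increase, so the window sums satisfy σ⁻¹(i) ≤ σ⁻¹(n + i).
      resC : lookup w i ≡ c → inv Ii < inv (suc m ℕ.+ Ii)
      resC eL = NP.≤∧≢⇒< (NP.+-cancelʳ-≤ Mid _ _ (subst₂ _≤_ (trans (diagonal-sum f0 p0 q0) window-sum-low) (trans (trans (diagonal-sum (suc f0) p1 q1) window-sum-high) (NP.+-comm Mid _))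
                    (sumUp-≤ (diagLabel f0) (diagLabel (suc f0)) (suc m) pt))) neq
        where
        tt : top w f0 ≡ top w (suc f0)
        tt = trans (top-mid w i) (cong (λ z → isRow z ℕ.+ top w (suc f0)) eL)
        pt : ∀ j → j < suc m → diagLabel f0 j ≤ diagLabel (suc f0) j
        pt j j< = rows-weak _ _ (full-diagonal-box f0 j p0 q0 (NP.≤-pred j<)) (full-diagonal-box (suc f0) j p1 q1 (NP.≤-pred j<)) (cong (λ z → + (z ℕ.+ j)) tt)
                    (subst (λ z → + (top w f0 ℕ.+ j ℕ.+ f0) - Kz ℤ.≤ + (z ℕ.+ j ℕ.+ suc f0) - Kz) tt (shifted-≤ (NP.+-monoʳ-≤ (top w f0 ℕ.+ j) (NP.n≤1+n f0))))

      -- Letter r: the diagonal m + i starts one row lower; along columns the labels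
      -- increase, so σ⁻¹(n + i) ≤ σ⁻¹(i).
      resR : lookup w i ≡ r → inv (suc m ℕ.+ Ii) < inv Ii
      resR eL = NP.≤∧≢⇒< (NP.+-cancelˡ-≤ Mid _ _ (subst₂ _≤_ (trans (diagonal-sum (suc f0) p1 q1) window-sum-high) (trans (trans (diagonal-sum f0 p0 q0) window-sum-low) (NP.+-comm (inv Ii) Mid))
                    (sumUp-≤ (diagLabel (suc f0)) (diagLabel f0) (suc m) pt))) (λ z → neq (sym z))
        where
        tt : top w f0 ≡ suc (top w (suc f0))
        tt = trans (top-mid w i) (cong (λ z → isRow z ℕ.+ top w (suc f0)) eL)
        pt : ∀ j → j < suc m → diagLabel (suc f0) j ≤ diagLabel f0 j
        pt j j< = columns-weak _ _ (full-diagonal-box (suc f0) j p1 q1 (NP.≤-pred j<)) (full-diagonal-box f0 j p0 q0 (NP.≤-pred j<))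
                    (cong (λ z → + z - Kz) (trans (NP.+-suc _ f0) (cong (λ z → z ℕ.+ j ℕ.+ f0) (sym tt))))
                    (ℤ.+≤+ (subst (λ z → top w (suc f0) ℕ.+ j ≤ z ℕ.+ j) (sym tt) (NP.n≤1+n _)))

    condition : Condition
    condition i = AtLetter.resC i , AtLetter.resR i


open import Defs
open import Data.Nat using (ℕ; _≤_; _+_; suc; s≤s; z≤n)
open import Data.Nat.Properties using (m≤n+m)
open import Data.Fin as Fin using (Fin; _↑ʳ_; inject≤)
open import Data.Vec using (Vec; lookup)
open import Data.Fin.Permutation using (Permutation′; _⟨$⟩ˡ_)
open import Relation.Binary.PropositionalEquality using (_≡_)
open import Data.Product using (_×_; _,_)
open import Function.Bundles using (_⇔_; mk⇔; Equivalence)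
open Windows using (module Window)
open Construction using (module Build)
open Necessity using (module Analyse)

mainTheorem4 : ∀ {k : ℕ} (w : Vec Letter k) (n : ℕ) → 1 ≤ n →
    (σ : Permutation′ (n + k)) →
    BSP w n σ ⇔
    (∀ (i : Fin k) →
    (lookup w i ≡ c → (σ ⟨$⟩ˡ inject≤ i (m≤n+m k n)) Fin.< (σ ⟨$⟩ˡ (n ↑ʳ i))) ×
    (lookup w i ≡ r → (σ ⟨$⟩ˡ (n ↑ʳ i)) Fin.< (σ ⟨$⟩ˡ inject≤ i (m≤n+m k n))))
mainTheorem4 {k} w (suc m) (s≤s z≤n) σ = mk⇔ necessary sufficient
  where
  open Window m k w σ using (StatedCondition; Condition⇔StatedCondition)
  open Equivalence Condition⇔StatedCondition using (to; from)
  necessary : BSP w (suc m) σ → StatedCondition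
  necessary (T , bst , ps) = to (Analyse.condition m k w σ T bst ps)
  sufficient : StatedCondition → BSP w (suc m) σ
  sufficient h = Build.fill-is-BST m k w σ (from h)
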